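{- Let $q$ be a prime power and $n,i,j,k$ nonnegative integers with $i,j,k\le n$. If $i\ge j$ and $i+j\ge k$, then $$P_q^n(i,j,k)\le M_q^n(i)\cdot 2\sum_{c=\lceil\frac{i+j-k}{2}\rceil}^{j}Q_q^n(i,j,c).$$
   Context: $M_q^n(k)$ is the number of $n\times n$ matrices over $\mathbb{F}_q$ of rank $k$. $P_q^n(i,j,k)$ is the number of pairs $(X,Y)$ of $n\times n$ matrices over $\mathbb{F}_q$ with $\mathrm{rk}(X)=i$, $\mathrm{rk}(Y)=j$ and $\mathrm{rk}(X-Y)\le k$. $Q_q^n(i,j,c)$ is the number of $n\times n$ matrices $Y$ over $\mathbb{F}_q$ of rank $j$ such that $\dim(\mathrm{col}(X)\cap\mathrm{col}(Y))=c$, for a fixed $n\times n$ matrix $X$ of rank $i$ (this number does not depend on the choice of $X$); $\mathrm{col}$ denotes column space. -}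

module Defs where

open import Level using (0ℓ)
open import Data.Nat using (ℕ; zero; suc; _∸_; _^_; _≤_; _⊔_; _/_)
import Data.Nat as ℕ
open import Data.Nat.Primality using (Prime)
open import Data.Bool using (Bool; true; false; _∧_; _∨_; not; if_then_else_)
open import Data.Fin using (Fin)
open import Data.Nat.ListAction using (sum)
open import Data.List using (List; []; _∷_; map; concatMap; length; upTo; filter; foldr; allFin)
open import Data.List.Relation.Unary.Unique.Propositional using (Unique)
open import Data.List.Membership.Propositional using (_∈_)
import Data.List as L
open import Data.Product using (Σ; _×_; _,_; ∃)
open import Relation.Nullary using (¬_; does)
open import Relation.Binary.PropositionalEquality using (_≡_)
open import Relation.Binary.Definitions using (DecidableEquality)
open import Algebra.Structures using (IsCommutativeRing)

IsPrimePower : ℕ → Set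
IsPrimePower q = Σ ℕ λ p → Σ ℕ λ m → Prime p × (1 ≤ m) × (q ≡ p ^ m)

record FiniteField : Set₁ where
  infixl 6 _+_
  infixl 7 _*_
  field
    Carrier : Set
    _+_ _*_ : Carrier → Carrier → Carrier
    -_      : Carrier → Carrier
    0# 1#   : Carrier
    isCommutativeRing : IsCommutativeRing _≡_ _+_ _*_ -_ 0# 1#
    0≢1     : ¬ (0# ≡ 1#)
    inverse : ∀ x → ¬ (x ≡ 0#) → Σ Carrier λ y → x * y ≡ 1#
    _≟_     : DecidableEquality Carrier
    elements : List Carrier
    unique   : Unique elements
    complete : ∀ x → x ∈ elements

  card : ℕ
  card = length elements

funs : {B : Set} → List B → (k : ℕ) → List (Fin k → B)
funs xs zero = (λ ()) ∷ []
funs xs (suc k) = concatMap (λ x → map (λ f → cons x f) (funs xs k)) xs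
  where
  cons : {B : Set} {k : ℕ} → B → (Fin k → B) → Fin (suc k) → B
  cons x f Fin.zero = x
  cons x f (Fin.suc i) = f i

count : {B : Set} → (B → Bool) → List B → ℕ
count p xs = length (L.filterᵇ p xs)

anyᵇ : {B : Set} → (B → Bool) → List B → Bool
anyᵇ p = foldr (λ x b → p x ∨ b) false

allᵇ : {B : Set} → (B → Bool) → List B → Bool
allᵇ p = foldr (λ x b → p x ∧ b) true

-- Σ_{c = lo}^{hi} f c  (empty if lo > hi)
sumFromTo : ℕ → ℕ → (ℕ → ℕ) → ℕ
sumFromTo lo hi f = sum (map (λ t → f (lo ℕ.+ t)) (upTo (suc hi ∸ lo)))

ceilHalf : ℕ → ℕ
ceilHalf m = suc m / 2

module _ (F : FiniteField) where
  open FiniteField F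

  -- column vectors of length n, n×n matrices (M r c = entry in row r, column c)
  Vector : ℕ → Set
  Vector n = Fin n → Carrier

  Mat : ℕ → Set
  Mat n = Fin n → Fin n → Carrier

  allVectors : (n : ℕ) → List (Vector n)
  allVectors n = funs elements n

  allMats : (n : ℕ) → List (Mat n)
  allMats n = funs (allVectors n) n

  Σᶠ : (k : ℕ) → (Fin k → Carrier) → Carrier
  Σᶠ k f = foldr (λ i acc → f i + acc) 0# (allFin k)

  _==_ : Carrier → Carrier → Bool
  x == y = does (x ≟ y)

  vecEq : {n : ℕ} → Vector n → Vector n → Bool
  vecEq {n} v w = allᵇ (λ r → v r == w r) (allFin n)

  isZeroVec : {n : ℕ} → Vector n → Bool
  isZeroVec v = vecEq v (λ _ → 0#)

  combo : {n k : ℕ} → (Fin k → Vector n) → (Fin k → Carrier) → Vector n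
  combo {n} {k} vs c r = Σᶠ k (λ t → c t * vs t r)

  linIndep : {n k : ℕ} → (Fin k → Vector n) → Bool
  linIndep {n} {k} vs =
    allᵇ (λ c → not (isZeroVec (combo vs c)) ∨ isZeroVec c) (allVectors k)

  Subspace : ℕ → Set
  Subspace n = Vector n → Bool

  hasIndep : {n : ℕ} → Subspace n → ℕ → Bool
  hasIndep {n} S k =
    anyᵇ (λ vs → allᵇ (λ t → S (vs t)) (allFin k) ∧ linIndep vs)
         (funs (allVectors n) k)

  dim : {n : ℕ} → Subspace n → ℕ
  dim {n} S = foldr (λ k acc → if hasIndep S k then k ⊔ acc else acc) 0 (upTo (suc n))

  mulVec : {n : ℕ} → Mat n → Vector n → Vector n
  mulVec {n} X v r = Σᶠ n (λ t → X r t * v t)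

  col : {n : ℕ} → Mat n → Subspace n
  col {n} X w = anyᵇ (λ v → vecEq (mulVec X v) w) (allVectors n)

  _∩_ : {n : ℕ} → Subspace n → Subspace n → Subspace n
  (S ∩ T) w = S w ∧ T w

  rk : {n : ℕ} → Mat n → ℕ
  rk X = dim (col X)

  _-ᴹ_ : {n : ℕ} → Mat n → Mat n → Mat n
  (X -ᴹ Y) r c = X r c + (- Y r c)

  _=ℕ_ : ℕ → ℕ → Bool
  a =ℕ b = does (a ℕ.≟ b)

  _≤ℕ_ : ℕ → ℕ → Bool
  a ≤ℕ b = does (a ℕ.≤? b)

  Mcount : (n k : ℕ) → ℕ
  Mcount n k = count (λ X → rk X =ℕ k) (allMats n)

  Pcount : (n i j k : ℕ) → ℕ
  Pcount n i j k =
    count (λ XY → let X = Data.Product.proj₁ XY ; Y = Data.Product.proj₂ XY in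
                  (rk X =ℕ i) ∧ (rk Y =ℕ j) ∧ (rk (X -ᴹ Y) ≤ℕ k))
          (L.cartesianProduct (allMats n) (allMats n))

  -- Q_q^n(i,j,c) for the given matrix X (of rank i)
  Qcount : (n : ℕ) → Mat n → (j c : ℕ) → ℕ
  Qcount n X j c =
    count (λ Y → (rk Y =ℕ j) ∧ (dim (col X ∩ col Y) =ℕ c)) (allMats n)

-- For X′ of rank i, the rank inequality
--   rk X′ + rk Y ≤ rk (X′ − Y) + dim (col X′ ∩ col Y) + dim (row X′ ∩ row Y)
-- shows that every Y of rank j with rk (X′ − Y) ≤ k has one of the two intersections of
-- dimension between ⌈(i + j − k)/2⌉ and j. Those Y of the first kind number at most
-- Σ_c Q(X′, j, c), and after transposing Y those of the second kind are counted by the same sum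
-- for X′ᵀ. Q depends on X′ only through its rank, since an automorphism of F^n carrying one
-- column space onto the other acts bijectively on matrices. Summing over the M(i) matrices X′
-- of rank i gives the bound.

module Submission where

open import Defs

module Counting where

  open import Data.Nat using (ℕ; zero; suc; _+_; _*_; _∸_; _^_; _⊔_; _≤_; _<_; z≤n; s≤s)
  import Data.Nat.Properties as ℕₚ
  open import Data.Nat.DivMod using (m/n*n≤m)
  open import Data.Nat.ListAction using (sum)
  open import Data.Nat.Tactic.RingSolver using (solve-∀)
  open import Data.Bool using (Bool; true; false; _∧_; _∨_; if_then_else_)
  open import Data.Bool.Properties using (∨-zeroʳ; ∧-conicalˡ; ∧-conicalʳ)
  open import Data.Empty using (⊥-elim)
  open import Data.Fin using (Fin)
  import Data.Fin as Fin
  open import Data.List using (List; []; _∷_; _++_; map; foldr; concatMap; length; upTo; cartesianProduct)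
  open import Data.List.Properties using (map-cong)
  open import Data.List.Membership.Propositional using (_∈_)
  open import Data.List.Membership.Propositional.Properties using (∈-upTo⁺)
  open import Data.List.Relation.Unary.All using (All; []; _∷_)
  import Data.List.Relation.Unary.All as All
  import Data.List.Relation.Unary.AllPairs as AllPairs
  open import Data.List.Relation.Unary.Any using (here; there)
  open import Data.List.Relation.Unary.Unique.Propositional using (Unique)
  open import Data.Product using (_×_; _,_; proj₁; proj₂; ∃)
  open import Data.Sum using (_⊎_; inj₁; inj₂)
  open import Relation.Nullary using (¬_; Dec; yes; no; does)
  open import Relation.Nullary.Decidable using (dec-true)
  open import Relation.Binary.Definitions using (DecidableEquality)
  open import Relation.Binary.PropositionalEquality

  does⇒ : ∀ {P : Set} (d : Dec P) → does d ≡ true → P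
  does⇒ (yes p) _ = p

  ∧-intro : ∀ {a b} → a ≡ true → b ≡ true → a ∧ b ≡ true
  ∧-intro refl refl = refl

  bool-ext : ∀ {a b : Bool} → (a ≡ true → b ≡ true) → (b ≡ true → a ≡ true) → a ≡ b
  bool-ext {true} f g = sym (f refl)
  bool-ext {false} {true} f g = g refl
  bool-ext {false} {false} f g = refl

  anyᵇ⇒ : ∀ {A : Set} (p : A → Bool) xs → anyᵇ p xs ≡ true → ∃ λ x → x ∈ xs × p x ≡ true
  anyᵇ⇒ p (x ∷ xs) h with p x in e
  ... | true = x , here refl , e
  ... | false with anyᵇ⇒ p xs h
  ...   | y , y∈xs , py = y , there y∈xs , py

  anyᵇ⇐ : ∀ {A : Set} (p : A → Bool) {x} xs → x ∈ xs → p x ≡ true → anyᵇ p xs ≡ true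
  anyᵇ⇐ p (y ∷ xs) (here refl) px rewrite px = refl
  anyᵇ⇐ p (y ∷ xs) (there x∈xs) px rewrite anyᵇ⇐ p xs x∈xs px = ∨-zeroʳ (p y)

  allᵇ⇒ : ∀ {A : Set} (p : A → Bool) {x} xs → allᵇ p xs ≡ true → x ∈ xs → p x ≡ true
  allᵇ⇒ p (y ∷ xs) h (here refl) = ∧-conicalˡ _ _ h
  allᵇ⇒ p (y ∷ xs) h (there x∈xs) = allᵇ⇒ p xs (∧-conicalʳ (p y) _ h) x∈xs

  allᵇ⇐ : ∀ {A : Set} (p : A → Bool) xs → (∀ x → x ∈ xs → p x ≡ true) → allᵇ p xs ≡ true
  allᵇ⇐ p [] h = refl
  allᵇ⇐ p (y ∷ xs) h = ∧-intro (h y (here refl)) (allᵇ⇐ p xs (λ x x∈xs → h x (there x∈xs)))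

  anyᵇ-cong : ∀ {A : Set} {p q : A → Bool} → (∀ x → p x ≡ q x) → ∀ xs → anyᵇ p xs ≡ anyᵇ q xs
  anyᵇ-cong e [] = refl
  anyᵇ-cong e (x ∷ xs) = cong₂ _∨_ (e x) (anyᵇ-cong e xs)

  allᵇ-cong : ∀ {A : Set} {p q : A → Bool} → (∀ x → p x ≡ q x) → ∀ xs → allᵇ p xs ≡ allᵇ q xs
  allᵇ-cong e [] = refl
  allᵇ-cong e (x ∷ xs) = cong₂ _∧_ (e x) (allᵇ-cong e xs)

  indicator : Bool → ℕ
  indicator true = 1
  indicator false = 0

  sumBy : {A : Set} → (A → ℕ) → List A → ℕ
  sumBy f [] = 0
  sumBy f (x ∷ xs) = f x + sumBy f xs

  -- Defs' count, recast as a sum of indicators so that it unfolds along the list.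
  tally : {A : Set} → (A → Bool) → List A → ℕ
  tally p = sumBy (λ x → indicator (p x))

  count≡tally : ∀ {A : Set} (p : A → Bool) xs → count p xs ≡ tally p xs
  count≡tally p [] = refl
  count≡tally p (x ∷ xs) with p x
  ... | true = cong suc (count≡tally p xs)
  ... | false = count≡tally p xs

  sum-map≡sumBy : ∀ {A : Set} (f : A → ℕ) xs → sum (map f xs) ≡ sumBy f xs
  sum-map≡sumBy f [] = refl
  sum-map≡sumBy f (x ∷ xs) = cong (f x +_) (sum-map≡sumBy f xs)

  sumBy-cong : ∀ {A : Set} {f g : A → ℕ} → (∀ x → f x ≡ g x) → ∀ xs → sumBy f xs ≡ sumBy g xs
  sumBy-cong e [] = refl
  sumBy-cong e (x ∷ xs) = cong₂ _+_ (e x) (sumBy-cong e xs)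

  sumBy-mono-≤ : ∀ {A : Set} {f g : A → ℕ} → (∀ x → f x ≤ g x) → ∀ xs → sumBy f xs ≤ sumBy g xs
  sumBy-mono-≤ e [] = z≤n
  sumBy-mono-≤ e (x ∷ xs) = ℕₚ.+-mono-≤ (e x) (sumBy-mono-≤ e xs)

  sumBy-distrib-+ : ∀ {A : Set} (f g : A → ℕ) xs →
    sumBy (λ x → f x + g x) xs ≡ sumBy f xs + sumBy g xs
  sumBy-distrib-+ f g [] = refl
  sumBy-distrib-+ f g (x ∷ xs) rewrite sumBy-distrib-+ f g xs = interchange (f x) (g x) (sumBy f xs) (sumBy g xs)
    where
    interchange : ∀ a b c d → a + b + (c + d) ≡ a + c + (b + d)
    interchange = solve-∀

  sumBy-*ˡ : ∀ {A : Set} (a : ℕ) (f : A → ℕ) xs → sumBy (λ x → a * f x) xs ≡ a * sumBy f xs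
  sumBy-*ˡ a f [] = sym (ℕₚ.*-zeroʳ a)
  sumBy-*ˡ a f (x ∷ xs) rewrite sumBy-*ˡ a f xs = sym (ℕₚ.*-distribˡ-+ a (f x) (sumBy f xs))

  sumBy-const : ∀ {A : Set} (a : ℕ) (xs : List A) → sumBy (λ _ → a) xs ≡ length xs * a
  sumBy-const a [] = refl
  sumBy-const a (x ∷ xs) = cong (a +_) (sumBy-const a xs)

  length≡sumBy-1 : ∀ {A : Set} (xs : List A) → length xs ≡ sumBy (λ _ → 1) xs
  length≡sumBy-1 xs = sym (trans (sumBy-const 1 xs) (ℕₚ.*-identityʳ (length xs)))

  sumBy-comm : ∀ {A B : Set} (f : A → B → ℕ) (xs : List A) (ys : List B) →
    sumBy (λ x → sumBy (f x) ys) xs ≡ sumBy (λ y → sumBy (λ x → f x y) xs) ys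
  sumBy-comm f [] ys = sym (trans (sumBy-const 0 ys) (ℕₚ.*-zeroʳ (length ys)))
  sumBy-comm f (x ∷ xs) ys rewrite sumBy-comm f xs ys = sym (sumBy-distrib-+ (f x) (λ y → sumBy (λ x → f x y) xs) ys)

  sumBy-++ : ∀ {A : Set} (f : A → ℕ) xs ys → sumBy f (xs ++ ys) ≡ sumBy f xs + sumBy f ys
  sumBy-++ f [] ys = refl
  sumBy-++ f (x ∷ xs) ys rewrite sumBy-++ f xs ys = sym (ℕₚ.+-assoc (f x) (sumBy f xs) (sumBy f ys))

  sumBy-map : ∀ {A B : Set} (f : B → ℕ) (g : A → B) xs → sumBy f (map g xs) ≡ sumBy (λ x → f (g x)) xs
  sumBy-map f g [] = refl
  sumBy-map f g (x ∷ xs) = cong (f (g x) +_) (sumBy-map f g xs)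

  sumBy-concatMap : ∀ {A B : Set} (f : B → ℕ) (h : A → List B) xs →
    sumBy f (concatMap h xs) ≡ sumBy (λ x → sumBy f (h x)) xs
  sumBy-concatMap f h [] = refl
  sumBy-concatMap f h (x ∷ xs) = trans (sumBy-++ f (h x) (concatMap h xs)) (cong (sumBy f (h x) +_) (sumBy-concatMap f h xs))

  sumBy-cartesianProduct : ∀ {A B : Set} (f : A → B → ℕ) (xs : List A) (ys : List B) →
    sumBy (λ xy → f (proj₁ xy) (proj₂ xy)) (cartesianProduct xs ys) ≡ sumBy (λ x → sumBy (f x) ys) xs
  sumBy-cartesianProduct f [] ys = refl
  sumBy-cartesianProduct f (x ∷ xs) ys =
    trans (sumBy-++ _ (map (x ,_) ys) _) (cong₂ _+_ (sumBy-map _ (x ,_) ys) (sumBy-cartesianProduct f xs ys))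

  ∈⇒≤sumBy : ∀ {A : Set} (f : A → ℕ) {x} xs → x ∈ xs → f x ≤ sumBy f xs
  ∈⇒≤sumBy f (y ∷ xs) (here refl) = ℕₚ.m≤m+n (f y) (sumBy f xs)
  ∈⇒≤sumBy f (y ∷ xs) (there x∈xs) = ℕₚ.≤-trans (∈⇒≤sumBy f xs x∈xs) (ℕₚ.m≤n+m (sumBy f xs) (f y))

  sumBy-indicator-* : ∀ {A : Set} (p : A → Bool) (a : ℕ) xs → sumBy (λ x → indicator (p x) * a) xs ≡ tally p xs * a
  sumBy-indicator-* p a [] = refl
  sumBy-indicator-* p a (x ∷ xs) rewrite sumBy-indicator-* p a xs = sym (ℕₚ.*-distribʳ-+ a (indicator (p x)) (tally p xs))

  tally-cong : ∀ {A : Set} {p q : A → Bool} → (∀ x → p x ≡ q x) → ∀ xs → tally p xs ≡ tally q xs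
  tally-cong e = sumBy-cong (λ x → cong indicator (e x))

  tally-mono : ∀ {A : Set} {p q : A → Bool} → (∀ x → p x ≡ true → q x ≡ true) → ∀ xs → tally p xs ≤ tally q xs
  tally-mono {p = p} {q} p⇒q = sumBy-mono-≤ pointwise
    where
    pointwise : ∀ x → indicator (p x) ≤ indicator (q x)
    pointwise x with p x in e
    ... | false = z≤n
    ... | true rewrite p⇒q x e = ℕₚ.≤-refl

  tally-∧ : ∀ {A : Set} (b : Bool) (q : A → Bool) xs → tally (λ x → b ∧ q x) xs ≡ indicator b * tally q xs
  tally-∧ true q xs = sym (ℕₚ.+-identityʳ (tally q xs))
  tally-∧ false q xs = trans (sumBy-const 0 xs) (ℕₚ.*-zeroʳ (length xs))

  tally-≤-+ : ∀ {A : Set} {p q r : A → Bool} → (∀ x → p x ≡ true → q x ≡ true ⊎ r x ≡ true) →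
    ∀ xs → tally p xs ≤ tally q xs + tally r xs
  tally-≤-+ {p = p} {q} {r} p⇒q∨r xs =
    ℕₚ.≤-trans (sumBy-mono-≤ pointwise xs) (ℕₚ.≤-reflexive (sumBy-distrib-+ _ _ xs))
    where
    pointwise : ∀ x → indicator (p x) ≤ indicator (q x) + indicator (r x)
    pointwise x with p x in e
    ... | false = z≤n
    ... | true with p⇒q∨r x e
    ...   | inj₁ qx rewrite qx = s≤s z≤n
    ...   | inj₂ rx rewrite rx = ℕₚ.m≤n+m 1 (indicator (q x))

  tally>0⇒∃ : ∀ {A : Set} (p : A → Bool) xs → 1 ≤ tally p xs → ∃ λ x → x ∈ xs × p x ≡ true
  tally>0⇒∃ p (x ∷ xs) h with p x in e
  ... | true = x , here refl , e
  ... | false with tally>0⇒∃ p xs h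
  ...   | y , y∈xs , py = y , there y∈xs , py

  tally-sumFromTo : ∀ {X : Set} (lo hi : ℕ) (p : X → Bool) (g : X → ℕ) (xs : List X) →
    tally (λ x → p x ∧ does (lo ℕₚ.≤? g x) ∧ does (g x ℕₚ.≤? hi)) xs ≤
      sumFromTo lo hi (λ c → count (λ x → p x ∧ does (g x ℕₚ.≟ c)) xs)
  tally-sumFromTo lo hi p g xs = begin
    tally inRange xs                                                ≤⟨ sumBy-mono-≤ pointwise xs ⟩
    sumBy (λ x → sumBy (λ t → indicator (hits t x)) (upTo N)) xs   ≡⟨ sumBy-comm _ xs (upTo N) ⟩
    sumBy (λ t → tally (hits t) xs) (upTo N)                        ≡⟨ sumBy-cong (λ t → count≡tally (hits t) xs) (upTo N) ⟨
    sumBy (λ t → count (hits t) xs) (upTo N)                        ≡⟨ sum-map≡sumBy _ (upTo N) ⟨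
    sumFromTo lo hi (λ c → count (λ x → p x ∧ does (g x ℕₚ.≟ c)) xs) ∎
    where
    open ℕₚ.≤-Reasoning
    N = suc hi ∸ lo
    inRange : _ → Bool
    inRange x = p x ∧ does (lo ℕₚ.≤? g x) ∧ does (g x ℕₚ.≤? hi)
    hits : ℕ → _ → Bool
    hits t x = p x ∧ does (g x ℕₚ.≟ lo + t)
    pointwise : ∀ x → indicator (inRange x) ≤ sumBy (λ t → indicator (hits t x)) (upTo N)
    pointwise x with inRange x in e
    ... | false = z≤n
    ... | true = ℕₚ.≤-trans (ℕₚ.≤-reflexive (sym hit)) (∈⇒≤sumBy _ (upTo N) (∈-upTo⁺ offset<N))
      where
      lo≤g = does⇒ (lo ℕₚ.≤? g x) (∧-conicalˡ _ _ (∧-conicalʳ (p x) _ e))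
      g≤hi = does⇒ (g x ℕₚ.≤? hi) (∧-conicalʳ (does (lo ℕₚ.≤? g x)) _ (∧-conicalʳ (p x) _ e))
      offset<N : g x ∸ lo < N
      offset<N = ℕₚ.∸-monoˡ-< (s≤s g≤hi) lo≤g
      hit : indicator (hits (g x ∸ lo) x) ≡ 1
      hit rewrite ∧-conicalˡ (p x) _ e | dec-true (g x ℕₚ.≟ lo + (g x ∸ lo)) (sym (ℕₚ.m+[n∸m]≡n lo≤g)) = refl

  -- Vectors and matrices are functions, so without function extensionality the lists of
  -- Defs enumerate them only up to a (decidable) pointwise equality.
  record BoolSetoid (A : Set) : Set where
    infix 4 _≐_
    field
      _≐_ : A → A → Bool
      ≐-sym : ∀ x y → (x ≐ y) ≡ (y ≐ x)
      ≐-trans : ∀ x y z → (x ≐ y) ≡ true → (y ≐ z) ≡ true → (x ≐ z) ≡ true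

  Enumerates : {A : Set} → BoolSetoid A → List A → Set
  Enumerates S xs = ∀ a → tally (λ x → x ≐ a) xs ≡ 1
    where open BoolSetoid S

  fromDecEq : ∀ {A : Set} → DecidableEquality A → BoolSetoid A
  fromDecEq _≟_ = record
    { _≐_ = λ x y → does (x ≟ y)
    ; ≐-sym = λ x y → bool-ext (λ h → dec-true (y ≟ x) (sym (does⇒ (x ≟ y) h)))
                               (λ h → dec-true (x ≟ y) (sym (does⇒ (y ≟ x) h)))
    ; ≐-trans = λ x y z x≡y y≡z → dec-true (x ≟ z) (trans (does⇒ (x ≟ y) x≡y) (does⇒ (y ≟ z) y≡z))
    }

  unique⇒enumerates : ∀ {A : Set} (_≟_ : DecidableEquality A) {xs} → Unique xs → (∀ x → x ∈ xs) →
    Enumerates (fromDecEq _≟_) xs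
  unique⇒enumerates _≟_ {xs} unique complete a = go xs unique (complete a)
    where
    absent : ∀ ys → All (λ y → ¬ (a ≡ y)) ys → tally (λ y → does (y ≟ a)) ys ≡ 0
    absent [] [] = refl
    absent (y ∷ ys) (a≢y ∷ a∉ys) with y ≟ a
    ... | yes y≡a = ⊥-elim (a≢y (sym y≡a))
    ... | no _ = absent ys a∉ys
    go : ∀ ys → Unique ys → a ∈ ys → tally (λ y → does (y ≟ a)) ys ≡ 1
    go (y ∷ ys) (y∉ys AllPairs.∷ _) (here refl) rewrite dec-true (y ≟ y) refl = cong suc (absent ys y∉ys)
    go (y ∷ ys) (y∉ys AllPairs.∷ u) (there a∈ys) with y ≟ a
    ... | yes refl = ⊥-elim (All.lookup y∉ys a∈ys refl)
    ... | no _ = go ys u a∈ys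

  module _ {B : Set} (S : BoolSetoid B) where
    open BoolSetoid S

    infix 4 _≐ᶠ_
    _≐ᶠ_ : ∀ {k} → (Fin k → B) → (Fin k → B) → Bool
    _≐ᶠ_ {zero} f g = true
    _≐ᶠ_ {suc k} f g = (f Fin.zero ≐ g Fin.zero) ∧ ((λ i → f (Fin.suc i)) ≐ᶠ (λ i → g (Fin.suc i)))

    ≐ᶠ⇒ : ∀ {k} (f g : Fin k → B) → (f ≐ᶠ g) ≡ true → ∀ i → (f i ≐ g i) ≡ true
    ≐ᶠ⇒ f g h Fin.zero = ∧-conicalˡ _ _ h
    ≐ᶠ⇒ f g h (Fin.suc i) = ≐ᶠ⇒ _ _ (∧-conicalʳ (f Fin.zero ≐ g Fin.zero) _ h) i

    ≐ᶠ⇐ : ∀ {k} (f g : Fin k → B) → (∀ i → (f i ≐ g i) ≡ true) → (f ≐ᶠ g) ≡ true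
    ≐ᶠ⇐ {zero} f g h = refl
    ≐ᶠ⇐ {suc k} f g h = ∧-intro (h Fin.zero) (≐ᶠ⇐ _ _ (λ i → h (Fin.suc i)))

    pointwiseSetoid : (k : ℕ) → BoolSetoid (Fin k → B)
    pointwiseSetoid k = record
      { _≐_ = _≐ᶠ_
      ; ≐-sym = λ f g → bool-ext (λ h → ≐ᶠ⇐ g f (λ i → trans (≐-sym (g i) (f i)) (≐ᶠ⇒ f g h i)))
                                 (λ h → ≐ᶠ⇐ f g (λ i → trans (≐-sym (f i) (g i)) (≐ᶠ⇒ g f h i)))
      ; ≐-trans = λ f g h f≐g g≐h → ≐ᶠ⇐ f h (λ i → ≐-trans (f i) (g i) (h i) (≐ᶠ⇒ f g f≐g i) (≐ᶠ⇒ g h g≐h i))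
      }

    funs-enumerates : ∀ {xs} → Enumerates S xs → ∀ k → Enumerates (pointwiseSetoid k) (funs xs k)
    funs-enumerates en zero f = refl
    funs-enumerates {xs} en (suc k) f = begin
      tally (_≐ᶠ f) (funs xs (suc k))
        ≡⟨ trans (sumBy-concatMap _ _ xs) (sumBy-cong (λ x → sumBy-map _ _ (funs xs k)) xs) ⟩
      sumBy (λ x → tally (λ g → (x ≐ f Fin.zero) ∧ (g ≐ᶠ tail f)) (funs xs k)) xs
        ≡⟨ sumBy-cong (λ x → tally-∧ (x ≐ f Fin.zero) _ (funs xs k)) xs ⟩
      sumBy (λ x → indicator (x ≐ f Fin.zero) * tally (_≐ᶠ tail f) (funs xs k)) xs
        ≡⟨ sumBy-cong (λ x → cong (indicator (x ≐ f Fin.zero) *_) (funs-enumerates en k (tail f))) xs ⟩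
      sumBy (λ x → indicator (x ≐ f Fin.zero) * 1) xs
        ≡⟨ sumBy-indicator-* _ 1 xs ⟩
      tally (_≐ f Fin.zero) xs * 1
        ≡⟨ cong (_* 1) (en (f Fin.zero)) ⟩
      1 ∎
      where
      open ≡-Reasoning
      tail : (Fin (suc k) → B) → Fin k → B
      tail g i = g (Fin.suc i)

  length-funs : ∀ {B : Set} (xs : List B) k → length (funs xs k) ≡ length xs ^ k
  length-funs xs zero = refl
  length-funs xs (suc k) = begin
    length (funs xs (suc k))                        ≡⟨ length≡sumBy-1 (funs xs (suc k)) ⟩
    sumBy (λ _ → 1) (funs xs (suc k))               ≡⟨ trans (sumBy-concatMap _ _ xs) (sumBy-cong (λ x → sumBy-map _ _ (funs xs k)) xs) ⟩
    sumBy (λ _ → sumBy (λ _ → 1) (funs xs k)) xs    ≡⟨ sumBy-cong (λ _ → trans (sym (length≡sumBy-1 (funs xs k))) (length-funs xs k)) xs ⟩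
    sumBy (λ _ → length xs ^ k) xs                  ≡⟨ sumBy-const (length xs ^ k) xs ⟩
    length xs * length xs ^ k                       ∎
    where open ≡-Reasoning

  module _ {A : Set} (S : BoolSetoid A) where
    open BoolSetoid S

    Respects : (A → Bool) → Set
    Respects p = ∀ x y → (x ≐ y) ≡ true → p x ≡ p y

    -- Double counting of the pairs (x , y) ∈ xs × ys with x ≐ y and p y.
    tally-reenumerate : ∀ xs ys → Enumerates S xs → Enumerates S ys →
      ∀ p → Respects p → tally p xs ≡ tally p ys
    tally-reenumerate xs ys en-xs en-ys p resp = begin
      sumBy (λ x → indicator (p x)) xs
        ≡⟨ sumBy-cong (λ x → multiplicity ys en-ys x) xs ⟨
      sumBy (λ x → sumBy (λ y → indicator (p x) * indicator (y ≐ x)) ys) xs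
        ≡⟨ sumBy-cong (λ x → sumBy-cong (λ y → swap x y) ys) xs ⟩
      sumBy (λ x → sumBy (λ y → indicator (p y) * indicator (x ≐ y)) ys) xs
        ≡⟨ sumBy-comm _ xs ys ⟩
      sumBy (λ y → sumBy (λ x → indicator (p y) * indicator (x ≐ y)) xs) ys
        ≡⟨ sumBy-cong (λ y → multiplicity xs en-xs y) ys ⟩
      sumBy (λ y → indicator (p y)) ys ∎
      where
      open ≡-Reasoning
      multiplicity : ∀ zs → Enumerates S zs → ∀ x →
        sumBy (λ z → indicator (p x) * indicator (z ≐ x)) zs ≡ indicator (p x)
      multiplicity zs en x = begin
        sumBy (λ z → indicator (p x) * indicator (z ≐ x)) zs ≡⟨ sumBy-*ˡ (indicator (p x)) _ zs ⟩
        indicator (p x) * tally (_≐ x) zs                    ≡⟨ cong (indicator (p x) *_) (en x) ⟩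
        indicator (p x) * 1                                  ≡⟨ ℕₚ.*-identityʳ _ ⟩
        indicator (p x)                                      ∎
      swap : ∀ x y → indicator (p x) * indicator (y ≐ x) ≡ indicator (p y) * indicator (x ≐ y)
      swap x y with y ≐ x in e
      ... | true rewrite trans (≐-sym x y) e | resp y x e = refl
      ... | false rewrite trans (≐-sym x y) e = trans (ℕₚ.*-zeroʳ (indicator (p x))) (sym (ℕₚ.*-zeroʳ (indicator (p y))))

    tally-∘-bijection : ∀ xs → Enumerates S xs → (φ ψ : A → A) → (∀ x a → (φ x ≐ a) ≡ (x ≐ ψ a)) →
      ∀ p → Respects p → tally p xs ≡ tally (λ x → p (φ x)) xs
    tally-∘-bijection xs en φ ψ adjoint p resp =
      trans (tally-reenumerate xs (map φ xs) en en-φxs p resp) (sumBy-map _ φ xs)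
      where
      en-φxs : Enumerates S (map φ xs)
      en-φxs a = trans (sumBy-map _ φ xs) (trans (tally-cong (λ x → adjoint x a) xs) (en (ψ a)))

    tally≤1 : ∀ xs → Enumerates S xs → ∀ p → (∀ x y → p x ≡ true → p y ≡ true → (x ≐ y) ≡ true) → tally p xs ≤ 1
    tally≤1 xs en p p-single with tally p xs in e
    ... | zero = z≤n
    ... | suc _ with tally>0⇒∃ p xs (subst (1 ≤_) (sym e) (s≤s z≤n))
    ...   | x₀ , _ , px₀ = subst (_≤ 1) e (subst (tally p xs ≤_) (en x₀) (tally-mono (λ x px → p-single x x₀ px px₀) xs))

  length-≤-injection : ∀ {A B : Set} (S : BoolSetoid A) (T : BoolSetoid B) (xs : List A) (ys : List B) →
    Enumerates S xs → Enumerates T ys → (φ : A → B) →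
    (∀ x y → BoolSetoid._≐_ T (φ x) (φ y) ≡ true → BoolSetoid._≐_ S x y ≡ true) → length xs ≤ length ys
  length-≤-injection S T xs ys en-xs en-ys φ φ-inj = begin
    length xs                                                 ≡⟨ length≡sumBy-1 xs ⟩
    sumBy (λ x → 1) xs                                        ≡⟨ sumBy-cong (λ x → en-ys (φ x)) xs ⟨
    sumBy (λ x → sumBy (λ y → indicator (y ≐ᵀ φ x)) ys) xs     ≡⟨ sumBy-comm _ xs ys ⟩
    sumBy (λ y → tally (λ x → y ≐ᵀ φ x) xs) ys                ≤⟨ sumBy-mono-≤ (λ y → tally≤1 S xs en-xs _ (fibre-single y)) ys ⟩
    sumBy (λ y → 1) ys                                        ≡⟨ length≡sumBy-1 ys ⟨
    length ys                                                 ∎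
    where
    open ℕₚ.≤-Reasoning
    open BoolSetoid T renaming (_≐_ to _≐ᵀ_)
    fibre-single : ∀ y x x′ → (y ≐ᵀ φ x) ≡ true → (y ≐ᵀ φ x′) ≡ true → BoolSetoid._≐_ S x x′ ≡ true
    fibre-single y x x′ p q = φ-inj x x′ (≐-trans (φ x) y (φ x′) (trans (≐-sym (φ x) y) p) q)

  enumerates⇒∃ : ∀ {A : Set} (S : BoolSetoid A) {xs} → Enumerates S xs → ∀ a →
    ∃ λ x → x ∈ xs × BoolSetoid._≐_ S x a ≡ true
  enumerates⇒∃ S {xs} en a = tally>0⇒∃ _ xs (subst (1 ≤_) (sym (en a)) (s≤s z≤n))

  -- dim F S in Defs unfolds to maxWhere (hasIndep F S) (upTo (suc n)).
  maxWhere : (ℕ → Bool) → List ℕ → ℕ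
  maxWhere P = foldr (λ k acc → if P k then k ⊔ acc else acc) 0

  ≤maxWhere : ∀ (P : ℕ → Bool) xs m → m ∈ xs → P m ≡ true → m ≤ maxWhere P xs
  ≤maxWhere P (x ∷ xs) m (here refl) Pm rewrite Pm = ℕₚ.m≤m⊔n m (maxWhere P xs)
  ≤maxWhere P (x ∷ xs) m (there m∈xs) Pm with P x
  ... | true = ℕₚ.≤-trans (≤maxWhere P xs m m∈xs Pm) (ℕₚ.m≤n⊔m x (maxWhere P xs))
  ... | false = ≤maxWhere P xs m m∈xs Pm

  maxWhere-satisfies : ∀ (P : ℕ → Bool) xs → P 0 ≡ true → P (maxWhere P xs) ≡ true
  maxWhere-satisfies P [] P0 = P0
  maxWhere-satisfies P (x ∷ xs) P0 with P x in Px
  ... | false = maxWhere-satisfies P xs P0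
  ... | true with ℕₚ.⊔-sel x (maxWhere P xs)
  ...   | inj₁ eq rewrite eq = Px
  ...   | inj₂ eq rewrite eq = maxWhere-satisfies P xs P0

  maxWhere-cong : ∀ {P Q : ℕ → Bool} → (∀ k → P k ≡ Q k) → ∀ xs → maxWhere P xs ≡ maxWhere Q xs
  maxWhere-cong P≡Q [] = refl
  maxWhere-cong P≡Q (x ∷ xs) rewrite P≡Q x | maxWhere-cong P≡Q xs = refl

  sumBy-indicator-*-≤ : ∀ {A : Set} (p : A → Bool) (g : A → ℕ) (b : ℕ) → (∀ x → p x ≡ true → g x ≤ b) →
    ∀ xs → sumBy (λ x → indicator (p x) * g x) xs ≤ tally p xs * b
  sumBy-indicator-*-≤ p g b g≤b xs = ℕₚ.≤-trans (sumBy-mono-≤ pointwise xs) (ℕₚ.≤-reflexive (sumBy-indicator-* p b xs))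
    where
    pointwise : ∀ x → indicator (p x) * g x ≤ indicator (p x) * b
    pointwise x with p x in e
    ... | false = z≤n
    ... | true = ℕₚ.*-monoʳ-≤ 1 (g≤b x e)

  sumFromTo-cong : ∀ lo hi {f g : ℕ → ℕ} → (∀ c → f c ≡ g c) → sumFromTo lo hi f ≡ sumFromTo lo hi g
  sumFromTo-cong lo hi f≡g = cong sum (map-cong (λ t → f≡g (lo + t)) (upTo (suc hi ∸ lo)))

  ceilHalf≤⊎ : ∀ m a b → m ≤ a + b → ceilHalf m ≤ a ⊎ ceilHalf m ≤ b
  ceilHalf≤⊎ m a b m≤a+b with ceilHalf m ℕₚ.≤? a | ceilHalf m ℕₚ.≤? b
  ... | yes h≤a | _ = inj₁ h≤a
  ... | no _ | yes h≤b = inj₂ h≤b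
  ... | no h≰a | no h≰b = ⊥-elim (ℕₚ.<⇒≱ a+b<m m≤a+b)
    where
    h = ceilHalf m
    double : ∀ x → x * 2 ≡ x + x
    double = solve-∀
    suc+suc : ∀ x y → suc x + suc y ≡ suc (suc (x + y))
    suc+suc = solve-∀
    a+b<m : a + b < m
    a+b<m = ℕₚ.≤-pred (subst (_≤ suc m) (suc+suc a b)
      (ℕₚ.≤-trans (ℕₚ.+-mono-≤ (ℕₚ.≰⇒> h≰a) (ℕₚ.≰⇒> h≰b)) (subst (_≤ suc m) (double h) (m/n*n≤m (suc m) 2))))

module LinearAlgebra (F : FiniteField) where

  open Counting

  open import Data.Nat using (ℕ; zero; suc; _^_; _≤_; _<_; s≤s)
  import Data.Nat as ℕ
  import Data.Nat.Properties as ℕₚ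
  open import Data.Bool using (Bool; true; false; _∧_; _∨_; not; if_then_else_)
  open import Data.Bool.Properties using (∧-conicalˡ; ∧-conicalʳ)
  import Data.Bool
  open import Data.Fin using (Fin; _↑ˡ_; _↑ʳ_; splitAt)
  import Data.Fin as Fin
  import Data.Fin.Properties as Finₚ
  open import Data.List using (List; []; _∷_; upTo; allFin)
  import Data.List as List
  open import Data.List.Membership.Propositional using (_∈_)
  open import Data.List.Membership.Propositional.Properties using (∈-allFin; ∈-upTo⁺)
  open import Data.Product using (Σ; _×_; _,_; proj₁; proj₂; ∃)
  open import Data.Sum using (inj₁; inj₂)
  open import Data.Empty using (⊥-elim)
  open import Data.Vec.Functional using (_++_) renaming (_∷_ to _∷ᵛ_)
  open import Relation.Nullary using (¬_; yes; no; does)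
  open import Relation.Nullary.Decidable using (dec-true)
  open import Relation.Binary.PropositionalEquality
  open import Algebra.Bundles using (CommutativeRing)
  open import Algebra.Structures using (IsCommutativeRing)

  open FiniteField F
  open IsCommutativeRing isCommutativeRing
    using ( +-assoc; +-comm; +-identityˡ; +-identityʳ; -‿inverseˡ; -‿inverseʳ
          ; *-assoc; *-comm; *-identityˡ; distribˡ; distribʳ; zeroˡ; zeroʳ )

  ring : CommutativeRing _ _
  ring = record { isCommutativeRing = isCommutativeRing }

  open import Algebra.Properties.Ring (CommutativeRing.ring ring)
    using (-‿distribˡ-*; -1*x≈-x; -0#≈0#; -‿involutive; -‿+-comm; x∙y⁻¹≈ε⇒x≈y; +-inverseʳ-unique)
  open import Algebra.Properties.Semiring.Sum (CommutativeRing.semiring ring)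
    using (sum; sum-syntax; sum-cong-≗; ∑-distrib-+; ∑-comm; *-distribˡ-sum; *-distribʳ-sum; sum-replicate-zero)
  open ≡-Reasoning

  V : ℕ → Set
  V = Vector F

  0ᵛ : ∀ {n} → V n
  0ᵛ _ = 0#

  Σᶠ≡sum : ∀ k (f : Fin k → Carrier) → Σᶠ F k f ≡ sum f
  Σᶠ≡sum k f = foldr-tabulate k (λ i → i) (λ i → refl)
    where
    foldr-tabulate : ∀ k {m} {g : Fin m → Carrier} {f : Fin k → Carrier} (h : Fin k → Fin m) → (∀ i → g (h i) ≡ f i) →
      List.foldr (λ i acc → g i + acc) 0# (List.tabulate h) ≡ sum f
    foldr-tabulate zero h e = refl
    foldr-tabulate (suc k) h e = cong₂ _+_ (e Fin.zero) (foldr-tabulate k (λ i → h (Fin.suc i)) (λ i → e (Fin.suc i)))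

  ∑-neg : ∀ k (f : Fin k → Carrier) → ∑[ i < k ] (- f i) ≡ - sum f
  ∑-neg zero f = sym -0#≈0#
  ∑-neg (suc k) f = trans (cong (- f Fin.zero +_) (∑-neg k (λ i → f (Fin.suc i)))) (-‿+-comm _ _)

  ∑-++ : ∀ a b (f : Fin (a ℕ.+ b) → Carrier) → sum f ≡ ∑[ i < a ] f (i ↑ˡ b) + ∑[ i < b ] f (a ↑ʳ i)
  ∑-++ zero b f = sym (+-identityˡ _)
  ∑-++ (suc a) b f = trans (cong (f Fin.zero +_) (∑-++ a b (λ i → f (Fin.suc i)))) (sym (+-assoc _ _ _))

  δ : ∀ {k} → Fin k → Fin k → Carrier
  δ i j = if does (i Finₚ.≟ j) then 1# else 0#

  ∑-δ : ∀ k (j : Fin k) (f : Fin k → Carrier) → ∑[ i < k ] (f i * δ i j) ≡ f j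
  ∑-δ (suc k) Fin.zero f = begin
    f Fin.zero * 1# + ∑[ i < k ] (f (Fin.suc i) * 0#) ≡⟨ cong₂ _+_ (trans (*-comm _ _) (*-identityˡ _)) (sum-cong-≗ {k} (λ i → zeroʳ _)) ⟩
    f Fin.zero + ∑[ i < k ] 0#                        ≡⟨ cong (f Fin.zero +_) (sum-replicate-zero k) ⟩
    f Fin.zero + 0#                                   ≡⟨ +-identityʳ _ ⟩
    f Fin.zero                                        ∎
  ∑-δ (suc k) (Fin.suc j) f = begin
    f Fin.zero * 0# + ∑[ i < k ] (f (Fin.suc i) * δ (Fin.suc i) (Fin.suc j)) ≡⟨ cong₂ _+_ (zeroʳ _) (sum-cong-≗ {k} (λ i → cong (f (Fin.suc i) *_) (δ-suc i))) ⟩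
    0# + ∑[ i < k ] (f (Fin.suc i) * δ i j)                                   ≡⟨ +-identityˡ _ ⟩
    ∑[ i < k ] (f (Fin.suc i) * δ i j)                                        ≡⟨ ∑-δ k j _ ⟩
    f (Fin.suc j)                                                             ∎
    where
    δ-suc : ∀ i → δ (Fin.suc i) (Fin.suc j) ≡ δ i j
    δ-suc i with i Finₚ.≟ j
    ... | yes _ = refl
    ... | no _ = refl

  infixl 6 _+ᵛ_
  infixr 7 _·ᵛ_

  _+ᵛ_ : ∀ {n} → V n → V n → V n
  (v +ᵛ w) r = v r + w r

  _·ᵛ_ : ∀ {n} → Carrier → V n → V n
  (a ·ᵛ v) r = a * v r

  -ᵛ_ : ∀ {n} → V n → V n
  (-ᵛ v) r = - v r

  lincomb : ∀ {n k} → (Fin k → V n) → V k → V n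
  lincomb {k = k} vs c r = ∑[ t < k ] (c t * vs t r)

  combo≗lincomb : ∀ {n k} (vs : Fin k → V n) c → combo F vs c ≗ lincomb vs c
  combo≗lincomb {k = k} vs c r = Σᶠ≡sum k _

  lincomb-cong : ∀ {n k} {vs ws : Fin k → V n} {c d : V k} → (∀ t → vs t ≗ ws t) → c ≗ d → lincomb vs c ≗ lincomb ws d
  lincomb-cong {k = k} vs≗ws c≗d r = sum-cong-≗ {k} (λ t → cong₂ _*_ (c≗d t) (vs≗ws t r))

  lincomb-congʳ : ∀ {n k} (vs : Fin k → V n) {c d : V k} → c ≗ d → lincomb vs c ≗ lincomb vs d
  lincomb-congʳ vs = lincomb-cong {vs = vs} (λ _ _ → refl)

  lincomb-+ : ∀ {n k} (vs : Fin k → V n) c d → lincomb vs (c +ᵛ d) ≗ lincomb vs c +ᵛ lincomb vs d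
  lincomb-+ {k = k} vs c d r = trans (sum-cong-≗ {k} (λ t → distribʳ (vs t r) (c t) (d t))) (∑-distrib-+ {k} _ _)

  lincomb-· : ∀ {n k} (vs : Fin k → V n) a c → lincomb vs (a ·ᵛ c) ≗ a ·ᵛ lincomb vs c
  lincomb-· {k = k} vs a c r = trans (sum-cong-≗ {k} (λ t → *-assoc a (c t) (vs t r))) (sym (*-distribˡ-sum {k} a _))

  lincomb-neg : ∀ {n k} (vs : Fin k → V n) c → lincomb vs (-ᵛ c) ≗ -ᵛ lincomb vs c
  lincomb-neg {k = k} vs c r = trans (sum-cong-≗ {k} (λ t → sym (-‿distribˡ-* (c t) (vs t r)))) (∑-neg k _)

  lincomb-0 : ∀ {n k} (vs : Fin k → V n) → lincomb vs 0ᵛ ≗ 0ᵛ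
  lincomb-0 {k = k} vs r = trans (sum-cong-≗ {k} (λ t → zeroˡ (vs t r))) (sum-replicate-zero k)

  lincomb-of-0 : ∀ {n k} (c : V k) → lincomb {n} (λ _ → 0ᵛ) c ≗ 0ᵛ
  lincomb-of-0 {k = k} c r = trans (sum-cong-≗ {k} (λ t → zeroʳ (c t))) (sum-replicate-zero k)

  ++-↑ˡ : ∀ {A : Set} {a b} (us : Fin a → A) (ws : Fin b → A) t → (us ++ ws) (t ↑ˡ b) ≡ us t
  ++-↑ˡ {a = a} {b} us ws t rewrite Finₚ.splitAt-↑ˡ a t b = refl

  ++-↑ʳ : ∀ {A : Set} {a b} (us : Fin a → A) (ws : Fin b → A) t → (us ++ ws) (a ↑ʳ t) ≡ ws t
  ++-↑ʳ {a = a} {b} us ws t rewrite Finₚ.splitAt-↑ʳ a b t = refl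

  Fin-+-elim : ∀ {a b} (P : Fin (a ℕ.+ b) → Set) → (∀ s → P (s ↑ˡ b)) → (∀ s → P (a ↑ʳ s)) → ∀ j → P j
  Fin-+-elim {a} {b} P left right j with splitAt a j in e
  ... | inj₁ s = subst P (Finₚ.splitAt⁻¹-↑ˡ e) (left s)
  ... | inj₂ s = subst P (Finₚ.splitAt⁻¹-↑ʳ e) (right s)

  lincomb-++ : ∀ {n a b} (us : Fin a → V n) (ws : Fin b → V n) c →
    lincomb (us ++ ws) c ≗ lincomb us (λ t → c (t ↑ˡ b)) +ᵛ lincomb ws (λ t → c (a ↑ʳ t))
  lincomb-++ {a = a} {b} us ws c r = trans (∑-++ a b _)
    (cong₂ _+_ (sum-cong-≗ {a} (λ t → cong (λ u → c (t ↑ˡ b) * u r) (++-↑ˡ us ws t)))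
               (sum-cong-≗ {b} (λ t → cong (λ w → c (a ↑ʳ t) * w r) (++-↑ʳ us ws t))))

  lincomb-++-split : ∀ {n a b} (us : Fin a → V n) (ws : Fin b → V n) c d →
    lincomb (us ++ ws) (c ++ d) ≗ lincomb us c +ᵛ lincomb ws d
  lincomb-++-split us ws c d r = trans (lincomb-++ us ws (c ++ d) r)
    (cong₂ _+_ (lincomb-congʳ us (++-↑ˡ c d) r) (lincomb-congʳ ws (++-↑ʳ c d) r))

  lincomb-lincomb : ∀ {n m k} (vs : Fin m → V n) (ws : Fin k → V n) (A : Fin m → V k) →
    (∀ t → vs t ≗ lincomb ws (A t)) → ∀ c → lincomb vs c ≗ lincomb ws (λ s → ∑[ t < m ] (c t * A t s))
  lincomb-lincomb {n} {m} {k} vs ws A vs≗ c r = begin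
    ∑[ t < m ] (c t * vs t r)                         ≡⟨ sum-cong-≗ {m} (λ t → cong (c t *_) (vs≗ t r)) ⟩
    ∑[ t < m ] (c t * ∑[ s < k ] (A t s * ws s r))    ≡⟨ sum-cong-≗ {m} (λ t → *-distribˡ-sum {k} (c t) _) ⟩
    ∑[ t < m ] ∑[ s < k ] (c t * (A t s * ws s r))    ≡⟨ ∑-comm {m} {k} _ ⟩
    ∑[ s < k ] ∑[ t < m ] (c t * (A t s * ws s r))    ≡⟨ sum-cong-≗ {k} (λ s → sum-cong-≗ {m} (λ t → sym (*-assoc (c t) (A t s) (ws s r)))) ⟩
    ∑[ s < k ] ∑[ t < m ] (c t * A t s * ws s r)      ≡⟨ sum-cong-≗ {k} (λ s → *-distribʳ-sum {m} (ws s r) _) ⟨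
    ∑[ s < k ] (∑[ t < m ] (c t * A t s) * ws s r)    ∎

  unit : ∀ {n} → Fin n → V n
  unit t s = δ t s

  lincomb-unit : ∀ {n} (c : V n) → lincomb unit c ≗ c
  lincomb-unit {n} c r = ∑-δ n r c

  carrierSetoid : BoolSetoid Carrier
  carrierSetoid = fromDecEq _≟_

  vectorSetoid : ∀ n → BoolSetoid (V n)
  vectorSetoid = pointwiseSetoid carrierSetoid

  matrixSetoid : ∀ n → BoolSetoid (Mat F n)
  matrixSetoid n = pointwiseSetoid (vectorSetoid n) n

  infix 4 _≐ᵛ_ _≐ᴹ_

  _≐ᵛ_ : ∀ {n} → V n → V n → Bool
  _≐ᵛ_ {n} = BoolSetoid._≐_ (vectorSetoid n)

  _≐ᴹ_ : ∀ {n} → Mat F n → Mat F n → Bool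
  _≐ᴹ_ {n} = BoolSetoid._≐_ (matrixSetoid n)

  ≐ᵛ⇒ : ∀ {n} (v w : V n) → (v ≐ᵛ w) ≡ true → v ≗ w
  ≐ᵛ⇒ v w h r = does⇒ (v r ≟ w r) (≐ᶠ⇒ carrierSetoid v w h r)

  ≐ᵛ⇐ : ∀ {n} (v w : V n) → v ≗ w → (v ≐ᵛ w) ≡ true
  ≐ᵛ⇐ v w v≗w = ≐ᶠ⇐ carrierSetoid v w (λ r → dec-true (v r ≟ w r) (v≗w r))

  ≐ᵛ-congʳ : ∀ {n} (u : V n) {v w : V n} → v ≗ w → (u ≐ᵛ v) ≡ (u ≐ᵛ w)
  ≐ᵛ-congʳ u {v} {w} v≗w = bool-ext (λ h → ≐ᵛ⇐ u w (λ r → trans (≐ᵛ⇒ u v h r) (v≗w r)))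
                                    (λ h → ≐ᵛ⇐ u v (λ r → trans (≐ᵛ⇒ u w h r) (sym (v≗w r))))

  ≐ᵛ-congˡ : ∀ {n} {u v : V n} (w : V n) → u ≗ v → (u ≐ᵛ w) ≡ (v ≐ᵛ w)
  ≐ᵛ-congˡ {u = u} {v} w u≗v = bool-ext (λ h → ≐ᵛ⇐ v w (λ r → trans (sym (u≗v r)) (≐ᵛ⇒ u w h r)))
                                        (λ h → ≐ᵛ⇐ u w (λ r → trans (u≗v r) (≐ᵛ⇒ v w h r)))

  ≐ᴹ⇒ : ∀ {n} (X Y : Mat F n) → (X ≐ᴹ Y) ≡ true → ∀ r s → X r s ≡ Y r s
  ≐ᴹ⇒ {n} X Y h r = ≐ᵛ⇒ (X r) (Y r) (≐ᶠ⇒ (vectorSetoid n) X Y h r)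

  ≐ᴹ⇐ : ∀ {n} (X Y : Mat F n) → (∀ r s → X r s ≡ Y r s) → (X ≐ᴹ Y) ≡ true
  ≐ᴹ⇐ {n} X Y X≡Y = ≐ᶠ⇐ (vectorSetoid n) X Y (λ r → ≐ᵛ⇐ (X r) (Y r) (X≡Y r))

  vecEq≡≐ᵛ : ∀ {n} (v w : V n) → vecEq F v w ≡ (v ≐ᵛ w)
  vecEq≡≐ᵛ {n} v w = bool-ext
    (λ h → ≐ᵛ⇐ v w (λ r → does⇒ (v r ≟ w r) (allᵇ⇒ _ (allFin n) h (∈-allFin r))))
    (λ h → allᵇ⇐ _ (allFin n) (λ r _ → dec-true (v r ≟ w r) (≐ᵛ⇒ v w h r)))

  elements-enumerate : Enumerates carrierSetoid elements
  elements-enumerate = unique⇒enumerates _≟_ unique complete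

  allVectors-enumerate : ∀ n → Enumerates (vectorSetoid n) (allVectors F n)
  allVectors-enumerate = funs-enumerates carrierSetoid elements-enumerate

  allMats-enumerate : ∀ n → Enumerates (matrixSetoid n) (allMats F n)
  allMats-enumerate n = funs-enumerates (vectorSetoid n) (allVectors-enumerate n) n

  ∃-∈-allVectors : ∀ {n} (v : V n) → ∃ λ v′ → v′ ∈ allVectors F n × v′ ≗ v
  ∃-∈-allVectors {n} v with enumerates⇒∃ (vectorSetoid n) (allVectors-enumerate n) v
  ... | v′ , v′∈ , v′≐v = v′ , v′∈ , ≐ᵛ⇒ v′ v v′≐v

  card≥2 : 2 ≤ card
  card≥2 = length-≤-injection (fromDecEq Data.Bool._≟_) carrierSetoid
    (false ∷ true ∷ []) elements bool-enumerate elements-enumerate (λ b → if b then 1# else 0#) embedding-injective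
    where
    bool-enumerate : Enumerates (fromDecEq Data.Bool._≟_) (false ∷ true ∷ [])
    bool-enumerate false = refl
    bool-enumerate true = refl
    embedding-injective : ∀ x y → does ((if x then 1# else 0#) ≟ (if y then 1# else 0#)) ≡ true → does (x Data.Bool.≟ y) ≡ true
    embedding-injective false false _ = refl
    embedding-injective true true _ = refl
    embedding-injective false true h = ⊥-elim (0≢1 (does⇒ (0# ≟ 1#) h))
    embedding-injective true false h = ⊥-elim (0≢1 (sym (does⇒ (1# ≟ 0#) h)))

  injection⇒≤ : ∀ {m k} (φ : V m → V k) → (∀ c c′ → φ c ≗ φ c′ → c ≗ c′) → m ≤ k
  injection⇒≤ {m} {k} φ φ-injective = ℕₚ.≮⇒≥ (λ k<m → ℕₚ.<⇒≱ (ℕₚ.^-monoʳ-< card card≥2 k<m) card^m≤card^k)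
    where
    card^m≤card^k : card ^ m ≤ card ^ k
    card^m≤card^k = subst₂ _≤_ (length-funs elements m) (length-funs elements k)
      (length-≤-injection (vectorSetoid m) (vectorSetoid k) (allVectors F m) (allVectors F k) (allVectors-enumerate m) (allVectors-enumerate k) φ
        (λ c c′ h → ≐ᵛ⇐ c c′ (φ-injective c c′ (≐ᵛ⇒ (φ c) (φ c′) h))))

  LinearlyIndependent : ∀ {n k} → (Fin k → V n) → Set
  LinearlyIndependent vs = ∀ c → lincomb vs c ≗ 0ᵛ → c ≗ 0ᵛ

  Within : ∀ {n k} → Subspace F n → (Fin k → V n) → Set
  Within S vs = ∀ t → S (vs t) ≡ true

  Spans : ∀ {n k} → Subspace F n → (Fin k → V n) → Set
  Spans {k = k} S vs = ∀ v → S v ≡ true → Σ (V k) λ c → lincomb vs c ≗ v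

  record Basis {n k} (S : Subspace F n) (vs : Fin k → V n) : Set where
    field
      within : Within S vs
      independent : LinearlyIndependent vs
      spans : Spans S vs

  Extensional : ∀ {n} → Subspace F n → Set
  Extensional S = ∀ v w → v ≗ w → S v ≡ S w

  record IsSubspace {n} (S : Subspace F n) : Set where
    field
      extensional : Extensional S
      0∈ : S 0ᵛ ≡ true
      +-closed : ∀ v w → S v ≡ true → S w ≡ true → S (v +ᵛ w) ≡ true
      ·-closed : ∀ a v → S v ≡ true → S (a ·ᵛ v) ≡ true

  lincomb-closed : ∀ {n k} {S : Subspace F n} → IsSubspace S → (vs : Fin k → V n) → Within S vs → ∀ c → S (lincomb vs c) ≡ true
  lincomb-closed {k = zero} S-sub vs _ c = IsSubspace.0∈ S-sub
  lincomb-closed {k = suc k} S-sub vs vs∈S c = IsSubspace.+-closed S-sub _ _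
    (IsSubspace.·-closed S-sub (c Fin.zero) (vs Fin.zero) (vs∈S Fin.zero))
    (lincomb-closed S-sub (λ t → vs (Fin.suc t)) (λ t → vs∈S (Fin.suc t)) (λ t → c (Fin.suc t)))

  -closed : ∀ {n} {S : Subspace F n} → IsSubspace S → ∀ v w → S v ≡ true → S w ≡ true → S (v +ᵛ -ᵛ w) ≡ true
  -closed S-sub v w v∈S w∈S = trans (IsSubspace.extensional S-sub _ _ (λ r → cong (v r +_) (sym (-1*x≈-x (w r)))))
    (IsSubspace.+-closed S-sub v _ v∈S (IsSubspace.·-closed S-sub (- 1#) w w∈S))

  independent-cong : ∀ {n k} {vs ws : Fin k → V n} → (∀ t → vs t ≗ ws t) → LinearlyIndependent vs → LinearlyIndependent ws
  independent-cong vs≗ws vs-indep c ws-c≗0 = vs-indep c (λ r → trans (lincomb-cong vs≗ws (λ _ → refl) r) (ws-c≗0 r))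

  lincomb-injective : ∀ {n k} (vs : Fin k → V n) → LinearlyIndependent vs → ∀ c d → lincomb vs c ≗ lincomb vs d → c ≗ d
  lincomb-injective vs vs-indep c d c≗d t = x∙y⁻¹≈ε⇒x≈y (c t) (d t) (vs-indep (c +ᵛ -ᵛ d) difference≗0 t)
    where
    difference≗0 : lincomb vs (c +ᵛ -ᵛ d) ≗ 0ᵛ
    difference≗0 r = begin
      lincomb vs (c +ᵛ -ᵛ d) r                  ≡⟨ lincomb-+ vs c (-ᵛ d) r ⟩
      lincomb vs c r + lincomb vs (-ᵛ d) r      ≡⟨ cong₂ _+_ (c≗d r) (lincomb-neg vs d r) ⟩
      lincomb vs d r + - lincomb vs d r         ≡⟨ -‿inverseʳ _ ⟩
      0#                                        ∎

  independent⇒≤ : ∀ {n k} (vs : Fin k → V n) → LinearlyIndependent vs → k ≤ n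
  independent⇒≤ vs vs-indep = injection⇒≤ (lincomb vs) (lincomb-injective vs vs-indep)

  -- Steinitz exchange, obtained by counting instead of elimination: the coordinates
  -- with respect to ws give an injection F^m → F^k.
  independent-in-span⇒≤ : ∀ {n m k} (vs : Fin m → V n) (ws : Fin k → V n) → LinearlyIndependent vs →
    (∀ t → Σ (V k) λ a → lincomb ws a ≗ vs t) → m ≤ k
  independent-in-span⇒≤ {n} {m} {k} vs ws vs-indep vs∈span = injection⇒≤ coordinates coordinates-injective
    where
    A : Fin m → V k
    A t = proj₁ (vs∈span t)
    coordinates : V m → V k
    coordinates c s = ∑[ t < m ] (c t * A t s)
    vs-via-ws : ∀ c → lincomb vs c ≗ lincomb ws (coordinates c)
    vs-via-ws = lincomb-lincomb vs ws A (λ t r → sym (proj₂ (vs∈span t) r))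
    coordinates-injective : ∀ c c′ → coordinates c ≗ coordinates c′ → c ≗ c′
    coordinates-injective c c′ e = lincomb-injective vs vs-indep c c′
      (λ r → trans (vs-via-ws c r) (trans (lincomb-congʳ ws e r) (sym (vs-via-ws c′ r))))

  isZeroVec⇒ : ∀ {n} (v : V n) → isZeroVec F v ≡ true → v ≗ 0ᵛ
  isZeroVec⇒ v h = ≐ᵛ⇒ v 0ᵛ (trans (sym (vecEq≡≐ᵛ v 0ᵛ)) h)

  isZeroVec⇐ : ∀ {n} (v : V n) → v ≗ 0ᵛ → isZeroVec F v ≡ true
  isZeroVec⇐ v v≗0 = trans (vecEq≡≐ᵛ v 0ᵛ) (≐ᵛ⇐ v 0ᵛ v≗0)

  linIndep⇒ : ∀ {n k} (vs : Fin k → V n) → linIndep F vs ≡ true → LinearlyIndependent vs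
  linIndep⇒ {n} {k} vs h c vs-c≗0 with ∃-∈-allVectors c
  ... | c′ , c′∈ , c′≗c = λ t → trans (sym (c′≗c t)) (isZeroVec⇒ c′ (trivial-only (allᵇ⇒ _ (allVectors F k) h c′∈)) t)
    where
    combo-zero : isZeroVec F (combo F vs c′) ≡ true
    combo-zero = isZeroVec⇐ _ (λ r → trans (combo≗lincomb vs c′ r) (trans (lincomb-congʳ vs c′≗c r) (vs-c≗0 r)))
    trivial-only : not (isZeroVec F (combo F vs c′)) ∨ isZeroVec F c′ ≡ true → isZeroVec F c′ ≡ true
    trivial-only h rewrite combo-zero = h

  linIndep⇐ : ∀ {n k} (vs : Fin k → V n) → LinearlyIndependent vs → linIndep F vs ≡ true
  linIndep⇐ {n} {k} vs vs-indep = allᵇ⇐ _ (allVectors F k) trivial-only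
    where
    trivial-only : ∀ c → c ∈ allVectors F k → not (isZeroVec F (combo F vs c)) ∨ isZeroVec F c ≡ true
    trivial-only c _ with isZeroVec F (combo F vs c) in e
    ... | false = refl
    ... | true = isZeroVec⇐ c (vs-indep c (λ r → trans (sym (combo≗lincomb vs c r)) (isZeroVec⇒ _ e r)))

  hasIndep⇒ : ∀ {n k} (S : Subspace F n) → hasIndep F S k ≡ true → Σ (Fin k → V n) λ vs → Within S vs × LinearlyIndependent vs
  hasIndep⇒ {n} {k} S h with anyᵇ⇒ _ (funs (allVectors F n) k) h
  ... | vs , _ , e = vs , (λ t → allᵇ⇒ _ (allFin k) (∧-conicalˡ _ _ e) (∈-allFin t)) , linIndep⇒ vs (∧-conicalʳ (allᵇ (λ t → S (vs t)) (allFin k)) _ e)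

  hasIndep⇐ : ∀ {n k} (S : Subspace F n) (vs : Fin k → V n) → (∀ t v → v ≗ vs t → S v ≡ true) →
    LinearlyIndependent vs → hasIndep F S k ≡ true
  hasIndep⇐ {n} {k} S vs near-vs∈S vs-indep with enumerates⇒∃ (pointwiseSetoid (vectorSetoid n) k) (funs-enumerates (vectorSetoid n) (allVectors-enumerate n) k) vs
  ... | ws , ws∈ , ws≐vs = anyᵇ⇐ _ (funs (allVectors F n) k) ws∈
    (∧-intro (allᵇ⇐ _ (allFin k) (λ t _ → near-vs∈S t (ws t) (ws≗vs t)))
             (linIndep⇐ ws (independent-cong (λ t r → sym (ws≗vs t r)) vs-indep)))
    where
    ws≗vs : ∀ t → ws t ≗ vs t
    ws≗vs t = ≐ᵛ⇒ (ws t) (vs t) (≐ᶠ⇒ (vectorSetoid n) ws vs ws≐vs t)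

  independent≤dim : ∀ {n k} (S : Subspace F n) → Extensional S → (vs : Fin k → V n) → Within S vs →
    LinearlyIndependent vs → k ≤ dim F S
  independent≤dim {n} {k} S S-ext vs vs∈S vs-indep =
    ≤maxWhere (hasIndep F S) (upTo (suc n)) k (∈-upTo⁺ (s≤s (independent⇒≤ vs vs-indep)))
      (hasIndep⇐ S vs (λ t v v≗vs → trans (S-ext v (vs t) v≗vs) (vs∈S t)) vs-indep)

  dim-witness : ∀ {n} (S : Subspace F n) → Σ (Fin (dim F S) → V n) λ vs → Within S vs × LinearlyIndependent vs
  dim-witness {n} S = hasIndep⇒ S (maxWhere-satisfies (hasIndep F S) (upTo (suc n)) (hasIndep⇐ {k = 0} S (λ ()) (λ ()) (λ c _ ())))

  dim≤spanning : ∀ {n k} (S : Subspace F n) (ws : Fin k → V n) → Spans S ws → dim F S ≤ k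
  dim≤spanning S ws ws-spans with dim-witness S
  ... | vs , vs∈S , vs-indep = independent-in-span⇒≤ vs ws vs-indep (λ t → ws-spans (vs t) (vs∈S t))

  dim-basis : ∀ {n k} (S : Subspace F n) → Extensional S → (vs : Fin k → V n) → Basis S vs → dim F S ≡ k
  dim-basis S S-ext vs vs-basis = ℕₚ.≤-antisym (dim≤spanning S vs (Basis.spans vs-basis))
    (independent≤dim S S-ext vs (Basis.within vs-basis) (Basis.independent vs-basis))

  dim-mono : ∀ {n} (S T : Subspace F n) → Extensional T → (∀ v → S v ≡ true → T v ≡ true) → dim F S ≤ dim F T
  dim-mono S T T-ext S⊆T with dim-witness S
  ... | vs , vs∈S , vs-indep = independent≤dim T T-ext vs (λ t → S⊆T (vs t) (vs∈S t)) vs-indep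

  dim-cong : ∀ {n} (S T : Subspace F n) → (∀ v → S v ≡ T v) → dim F S ≡ dim F T
  dim-cong {n} S T S≡T = maxWhere-cong (λ k → anyᵇ-cong (λ vs → cong (_∧ linIndep F vs) (allᵇ-cong (λ t → S≡T (vs t)) (allFin k)))
                                                        (funs (allVectors F n) k)) (upTo (suc n))

  full : ∀ n → Subspace F n
  full n _ = true

  full-basis : ∀ n → Basis (full n) unit
  full-basis n = record
    { within = λ _ → refl
    ; independent = λ c unit-c≗0 r → trans (sym (lincomb-unit c r)) (unit-c≗0 r)
    ; spans = λ v _ → v , lincomb-unit v
    }

  dim-full : ∀ n → dim F (full n) ≡ n
  dim-full n = dim-basis (full n) (λ _ _ _ → refl) unit (full-basis n)

  dim-trivial : ∀ {n} (S : Subspace F n) → (∀ v → S v ≡ true → v ≗ 0ᵛ) → dim F S ≡ 0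
  dim-trivial S S≗0 = ℕₚ.n≤0⇒n≡0 (dim≤spanning S (λ ()) (λ v v∈S → (λ ()) , (λ r → sym (S≗0 v v∈S r))))

  spanᵇ : ∀ {n k} → (Fin k → V n) → Subspace F n
  spanᵇ {n} {k} vs v = anyᵇ (λ c → lincomb vs c ≐ᵛ v) (allVectors F k)

  spanᵇ⇒ : ∀ {n k} (vs : Fin k → V n) v → spanᵇ vs v ≡ true → Σ (V k) λ c → lincomb vs c ≗ v
  spanᵇ⇒ {n} {k} vs v h with anyᵇ⇒ _ (allVectors F k) h
  ... | c , _ , e = c , ≐ᵛ⇒ _ v e

  spanᵇ⇐ : ∀ {n k} (vs : Fin k → V n) v c → lincomb vs c ≗ v → spanᵇ vs v ≡ true
  spanᵇ⇐ {n} {k} vs v c vs-c≗v with ∃-∈-allVectors c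
  ... | c′ , c′∈ , c′≗c = anyᵇ⇐ _ (allVectors F k) c′∈ (≐ᵛ⇐ _ v (λ r → trans (lincomb-congʳ vs c′≗c r) (vs-c≗v r)))

  spanᵇ-extensional : ∀ {n k} (vs : Fin k → V n) → Extensional (spanᵇ vs)
  spanᵇ-extensional {n} {k} vs v w v≗w = anyᵇ-cong (λ c → ≐ᵛ-congʳ (lincomb vs c) v≗w) (allVectors F k)

  independent-∷ : ∀ {n k} (vs : Fin k → V n) v → LinearlyIndependent vs → (∀ c → ¬ (lincomb vs c ≗ v)) →
    LinearlyIndependent (v ∷ᵛ vs)
  independent-∷ {n} {k} vs v vs-indep v∉span c vvs-c≗0 with c Fin.zero ≟ 0#
  ... | yes c₀≡0 = λ { Fin.zero → c₀≡0 ; (Fin.suc t) → rest≗0 t }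
    where
    rest≗0 : ∀ t → c (Fin.suc t) ≡ 0#
    rest≗0 = vs-indep (λ t → c (Fin.suc t)) (λ r → begin
      lincomb vs (λ t → c (Fin.suc t)) r                         ≡⟨ +-identityˡ _ ⟨
      0# + lincomb vs (λ t → c (Fin.suc t)) r                    ≡⟨ cong (_+ lincomb vs (λ t → c (Fin.suc t)) r) (trans (cong (_* v r) c₀≡0) (zeroˡ (v r))) ⟨
      c Fin.zero * v r + lincomb vs (λ t → c (Fin.suc t)) r      ≡⟨ vvs-c≗0 r ⟩
      0#                                                         ∎)
  ... | no c₀≢0 = ⊥-elim (v∉span (-ᵛ (c₀⁻¹ ·ᵛ rest)) v-in-span)
    where
    c₀⁻¹ = proj₁ (inverse (c Fin.zero) c₀≢0)
    c₀⁻¹c₀≡1 : c₀⁻¹ * c Fin.zero ≡ 1#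
    c₀⁻¹c₀≡1 = trans (*-comm _ _) (proj₂ (inverse (c Fin.zero) c₀≢0))
    rest = λ t → c (Fin.suc t)
    w = lincomb vs rest
    v+c₀⁻¹w≡0 : ∀ r → v r + c₀⁻¹ * w r ≡ 0#
    v+c₀⁻¹w≡0 r = begin
      v r + c₀⁻¹ * w r                         ≡⟨ cong (_+ c₀⁻¹ * w r) (*-identityˡ (v r)) ⟨
      1# * v r + c₀⁻¹ * w r                    ≡⟨ cong (λ x → x * v r + c₀⁻¹ * w r) c₀⁻¹c₀≡1 ⟨
      c₀⁻¹ * c Fin.zero * v r + c₀⁻¹ * w r     ≡⟨ cong (_+ c₀⁻¹ * w r) (*-assoc _ _ _) ⟩
      c₀⁻¹ * (c Fin.zero * v r) + c₀⁻¹ * w r   ≡⟨ distribˡ c₀⁻¹ _ _ ⟨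
      c₀⁻¹ * (c Fin.zero * v r + w r)          ≡⟨ cong (c₀⁻¹ *_) (vvs-c≗0 r) ⟩
      c₀⁻¹ * 0#                                ≡⟨ zeroʳ c₀⁻¹ ⟩
      0#                                       ∎
    v-in-span : lincomb vs (-ᵛ (c₀⁻¹ ·ᵛ rest)) ≗ v
    v-in-span r = begin
      lincomb vs (-ᵛ (c₀⁻¹ ·ᵛ rest)) r   ≡⟨ lincomb-neg vs _ r ⟩
      - lincomb vs (c₀⁻¹ ·ᵛ rest) r      ≡⟨ cong -_ (lincomb-· vs c₀⁻¹ rest r) ⟩
      - (c₀⁻¹ * w r)                     ≡⟨ cong -_ (+-inverseʳ-unique (v r) _ (v+c₀⁻¹w≡0 r)) ⟩
      - - v r                            ≡⟨ -‿involutive (v r) ⟩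
      v r                                ∎

  noVectors : ∀ {n} → Fin 0 → V n
  noVectors ()

  ∷-++ : ∀ {A : Set} {e a} (v : A) (ws : Fin e → A) (us : Fin a → A) t → ((v ∷ᵛ ws) ++ us) t ≡ (v ∷ᵛ (ws ++ us)) t
  ∷-++ v ws us Fin.zero = refl
  ∷-++ {e = e} v ws us (Fin.suc t) with splitAt e t
  ... | inj₁ _ = refl
  ... | inj₂ _ = refl

  module _ {n a} {S : Subspace F n} (S-sub : IsSubspace S) (us : Fin a → V n) where

    BasisExtension : Set
    BasisExtension = Σ ℕ λ e → Σ (Fin e → V n) λ ws → Basis S (ws ++ us)

    -- Each round adjoins a vector of S outside the current span; the fuel bounds the rounds by n.
    private
      extend : ∀ fuel {e} (ws : Fin e → V n) → n ≤ e ℕ.+ a ℕ.+ fuel → Within S (ws ++ us) →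
        LinearlyIndependent (ws ++ us) → BasisExtension
      extend fuel {e} ws bound ws++us∈S ws++us-indep
        with anyᵇ (λ v → S v ∧ not (spanᵇ (ws ++ us) v)) (allVectors F n) in found
      ... | false = e , ws , record { within = ws++us∈S ; independent = ws++us-indep ; spans = saturated }
        where
        saturated : Spans S (ws ++ us)
        saturated v v∈S with spanᵇ (ws ++ us) v in v-spanned
        ... | true = spanᵇ⇒ _ v v-spanned
        ... | false with ∃-∈-allVectors v
        ...   | v′ , v′∈ , v′≗v with () ← trans (sym found) (anyᵇ⇐ _ (allVectors F n) v′∈
                (∧-intro (trans (IsSubspace.extensional S-sub v′ v v′≗v) v∈S)
                         (cong not (trans (spanᵇ-extensional (ws ++ us) v′ v v′≗v) v-spanned))))
      ... | true with anyᵇ⇒ _ (allVectors F n) found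
      ...   | v , _ , v-escapes = adjoin fuel bound
        where
        v∉span : ∀ c → ¬ (lincomb (ws ++ us) c ≗ v)
        v∉span c c≗v with () ← trans (sym (cong not (spanᵇ⇐ (ws ++ us) v c c≗v))) (∧-conicalʳ (S v) _ v-escapes)
        v∷ws++us-indep : LinearlyIndependent (v ∷ᵛ (ws ++ us))
        v∷ws++us-indep = independent-∷ (ws ++ us) v ws++us-indep v∉span
        adjoin : ∀ fuel → n ≤ e ℕ.+ a ℕ.+ fuel → BasisExtension
        adjoin zero bound = ⊥-elim (ℕₚ.<⇒≱ (independent⇒≤ (v ∷ᵛ (ws ++ us)) v∷ws++us-indep) (subst (n ≤_) (ℕₚ.+-identityʳ _) bound))
        adjoin (suc fuel) bound = extend fuel (v ∷ᵛ ws) (subst (n ≤_) (ℕₚ.+-suc (e ℕ.+ a) fuel) bound)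
          (λ { Fin.zero → ∧-conicalˡ _ _ v-escapes ; (Fin.suc t) → trans (cong S (∷-++ v ws us (Fin.suc t))) (ws++us∈S t) })
          (independent-cong (λ t r → cong (λ x → x r) (sym (∷-++ v ws us t))) v∷ws++us-indep)

    basis-extension : Within S us → LinearlyIndependent us → BasisExtension
    basis-extension = extend n noVectors (ℕₚ.m≤n+m n a)

  basis-exists : ∀ {n} {S : Subspace F n} → IsSubspace S → Σ ℕ λ d → Σ (Fin d → V n) λ ws → Basis S ws
  basis-exists S-sub with basis-extension S-sub noVectors (λ ()) (λ c _ ())
  ... | e , ws , ws-basis = e ℕ.+ 0 , ws ++ noVectors , ws-basis

  record LinearMap (n m : ℕ) : Set where
    field
      apply : V n → V m
      apply-cong : ∀ v w → v ≗ w → apply v ≗ apply w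
      apply-+ : ∀ v w → apply (v +ᵛ w) ≗ apply v +ᵛ apply w
      apply-· : ∀ a v → apply (a ·ᵛ v) ≗ a ·ᵛ apply v

  open LinearMap public

  apply-0 : ∀ {n m} (L : LinearMap n m) → apply L 0ᵛ ≗ 0ᵛ
  apply-0 L r = begin
    apply L 0ᵛ r          ≡⟨ apply-cong L 0ᵛ (0# ·ᵛ 0ᵛ) (λ _ → sym (zeroˡ 0#)) r ⟩
    apply L (0# ·ᵛ 0ᵛ) r  ≡⟨ apply-· L 0# 0ᵛ r ⟩
    0# * apply L 0ᵛ r     ≡⟨ zeroˡ _ ⟩
    0#                    ∎

  apply-neg : ∀ {n m} (L : LinearMap n m) v → apply L (-ᵛ v) ≗ -ᵛ apply L v
  apply-neg L v r = begin
    apply L (-ᵛ v) r          ≡⟨ apply-cong L _ ((- 1#) ·ᵛ v) (λ i → sym (-1*x≈-x (v i))) r ⟩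
    apply L ((- 1#) ·ᵛ v) r   ≡⟨ apply-· L (- 1#) v r ⟩
    - 1# * apply L v r        ≡⟨ -1*x≈-x _ ⟩
    - apply L v r             ∎

  apply-− : ∀ {n m} (L : LinearMap n m) v w → apply L (v +ᵛ -ᵛ w) ≗ apply L v +ᵛ -ᵛ apply L w
  apply-− L v w r = trans (apply-+ L v _ r) (cong (apply L v r +_) (apply-neg L w r))

  apply-lincomb : ∀ {n m k} (L : LinearMap n m) (vs : Fin k → V n) c → apply L (lincomb vs c) ≗ lincomb (λ t → apply L (vs t)) c
  apply-lincomb {k = zero} L vs c = apply-0 L
  apply-lincomb {k = suc k} L vs c r = trans (apply-+ L _ _ r)
    (cong₂ _+_ (apply-· L (c Fin.zero) (vs Fin.zero) r) (apply-lincomb L (λ t → vs (Fin.suc t)) (λ t → c (Fin.suc t)) r))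

  _ᵀ : ∀ {m n} → (Fin m → Fin n → Carrier) → Fin n → Fin m → Carrier
  (A ᵀ) i j = A j i

  matVec : ∀ {m n} → (Fin m → Fin n → Carrier) → V n → V m
  matVec {n = n} A v r = ∑[ t < n ] (A r t * v t)

  matVec-cong : ∀ {m n} {A B : Fin m → Fin n → Carrier} → (∀ r s → A r s ≡ B r s) → ∀ v → matVec A v ≗ matVec B v
  matVec-cong {n = n} A≡B v r = sum-cong-≗ {n} (λ t → cong (_* v t) (A≡B r t))

  matVec-− : ∀ {m n} (A B : Fin m → Fin n → Carrier) v →
    matVec (λ r c → A r c + - B r c) v ≗ matVec A v +ᵛ -ᵛ matVec B v
  matVec-− {n = n} A B v r = begin
    ∑[ t < n ] ((A r t + - B r t) * v t)          ≡⟨ sum-cong-≗ {n} (λ t → trans (distribʳ (v t) _ _) (cong (A r t * v t +_) (sym (-‿distribˡ-* _ _)))) ⟩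
    ∑[ t < n ] (A r t * v t + - (B r t * v t))    ≡⟨ ∑-distrib-+ {n} _ _ ⟩
    matVec A v r + ∑[ t < n ] (- (B r t * v t))   ≡⟨ cong (matVec A v r +_) (∑-neg n _) ⟩
    matVec A v r + - matVec B v r                 ∎

  matVec-−≗0 : ∀ {m n} (A B : Fin m → Fin n → Carrier) v →
    matVec (λ r c → A r c + - B r c) v ≗ 0ᵛ → matVec A v ≗ matVec B v
  matVec-−≗0 A B v h r = x∙y⁻¹≈ε⇒x≈y _ _ (trans (sym (matVec-− A B v r)) (h r))

  matVec-++ : ∀ {a b n} (A : Fin a → Fin n → Carrier) (B : Fin b → Fin n → Carrier) v →
    (∀ s → matVec (A ++ B) v (s ↑ˡ b) ≡ matVec A v s) × (∀ s → matVec (A ++ B) v (a ↑ʳ s) ≡ matVec B v s)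
  matVec-++ {n = n} A B v =
    (λ s → sum-cong-≗ {n} (λ t → cong (λ row → row t * v t) (++-↑ˡ A B s))) ,
    (λ s → sum-cong-≗ {n} (λ t → cong (λ row → row t * v t) (++-↑ʳ A B s)))

  matVec-++ᵀ : ∀ {a b n} (A : Fin a → Fin n → Carrier) (B : Fin b → Fin n → Carrier) c →
    matVec ((A ++ B) ᵀ) c ≗ matVec (A ᵀ) (λ s → c (s ↑ˡ b)) +ᵛ matVec (B ᵀ) (λ s → c (a ↑ʳ s))
  matVec-++ᵀ {a} {b} A B c i = trans (∑-++ a b _)
    (cong₂ _+_ (sum-cong-≗ {a} (λ s → cong (λ row → row i * c (s ↑ˡ b)) (++-↑ˡ A B s)))
               (sum-cong-≗ {b} (λ s → cong (λ row → row i * c (a ↑ʳ s)) (++-↑ʳ A B s))))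

  columns : ∀ {m n} → (Fin m → Fin n → Carrier) → Fin n → V m
  columns A s ρ = A ρ s

  matVec≗lincomb-columns : ∀ {m n} (A : Fin m → Fin n → Carrier) v → matVec A v ≗ lincomb (columns A) v
  matVec≗lincomb-columns {n = n} A v r = sum-cong-≗ {n} (λ t → *-comm (A r t) (v t))

  mulVec≗matVec : ∀ {n} (X : Mat F n) v → mulVec F X v ≗ matVec X v
  mulVec≗matVec {n} X v r = Σᶠ≡sum n _

  matrixMap : ∀ {m n} → (Fin m → Fin n → Carrier) → LinearMap n m
  matrixMap {m} {n} A = record
    { apply = matVec A
    ; apply-cong = λ v w v≗w r → sum-cong-≗ {n} (λ t → cong (A r t *_) (v≗w t))
    ; apply-+ = λ v w r → trans (sum-cong-≗ {n} (λ t → distribˡ (A r t) (v t) (w t))) (∑-distrib-+ {n} _ _)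
    ; apply-· = λ a v r → trans (sum-cong-≗ {n} (λ t → commute (A r t) a (v t))) (sym (*-distribˡ-sum {n} a _))
    }
    where
    commute : ∀ x a y → x * (a * y) ≡ a * (x * y)
    commute x a y = trans (sym (*-assoc x a y)) (trans (cong (_* y) (*-comm x a)) (*-assoc a x y))

  lincombMap : ∀ {n k} → (Fin k → V n) → LinearMap k n
  lincombMap vs = record
    { apply = lincomb vs
    ; apply-cong = λ c d → lincomb-congʳ vs
    ; apply-+ = lincomb-+ vs
    ; apply-· = lincomb-· vs
    }

  infixr 7 _∩ˢ_

  _∩ˢ_ : ∀ {n} → Subspace F n → Subspace F n → Subspace F n
  _∩ˢ_ = _∩_ F

  kernel : ∀ {n m} → LinearMap n m → Subspace F n
  kernel L v = apply L v ≐ᵛ 0ᵛ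

  image : ∀ {n m} → LinearMap n m → Subspace F n → Subspace F m
  image {n} L W w = anyᵇ (λ v → W v ∧ (apply L v ≐ᵛ w)) (allVectors F n)

  image⇒ : ∀ {n m} (L : LinearMap n m) W w → image L W w ≡ true → Σ (V n) λ v → W v ≡ true × apply L v ≗ w
  image⇒ {n} L W w h with anyᵇ⇒ _ (allVectors F n) h
  ... | v , _ , e = v , ∧-conicalˡ _ _ e , ≐ᵛ⇒ _ w (∧-conicalʳ (W v) _ e)

  image⇐ : ∀ {n m} (L : LinearMap n m) W → Extensional W → ∀ v w → W v ≡ true → apply L v ≗ w → image L W w ≡ true
  image⇐ {n} L W W-ext v w v∈W Lv≗w with ∃-∈-allVectors v
  ... | v′ , v′∈ , v′≗v = anyᵇ⇐ _ (allVectors F n) v′∈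
    (∧-intro (trans (W-ext v′ v v′≗v) v∈W) (≐ᵛ⇐ _ w (λ r → trans (apply-cong L v′ v v′≗v r) (Lv≗w r))))

  full-subspace : ∀ n → IsSubspace (full n)
  full-subspace n = record { extensional = λ _ _ _ → refl ; 0∈ = refl ; +-closed = λ _ _ _ _ → refl ; ·-closed = λ _ _ _ → refl }

  kernel-subspace : ∀ {n m} (L : LinearMap n m) → IsSubspace (kernel L)
  kernel-subspace L = record
    { extensional = λ v w v≗w → ≐ᵛ-congˡ 0ᵛ (apply-cong L v w v≗w)
    ; 0∈ = ≐ᵛ⇐ _ _ (apply-0 L)
    ; +-closed = λ v w Lv≗0 Lw≗0 → ≐ᵛ⇐ _ _ (λ r → trans (apply-+ L v w r)
        (trans (cong₂ _+_ (≐ᵛ⇒ _ _ Lv≗0 r) (≐ᵛ⇒ _ _ Lw≗0 r)) (+-identityˡ 0#)))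
    ; ·-closed = λ a v Lv≗0 → ≐ᵛ⇐ _ _ (λ r → trans (apply-· L a v r) (trans (cong (a *_) (≐ᵛ⇒ _ _ Lv≗0 r)) (zeroʳ a)))
    }

  ∩-subspace : ∀ {n} {S T : Subspace F n} → IsSubspace S → IsSubspace T → IsSubspace (S ∩ˢ T)
  ∩-subspace {S = S} S-sub T-sub = record
    { extensional = λ v w v≗w → cong₂ _∧_ (S.extensional v w v≗w) (T.extensional v w v≗w)
    ; 0∈ = ∧-intro S.0∈ T.0∈
    ; +-closed = λ v w v∈ w∈ → ∧-intro (S.+-closed v w (∧-conicalˡ _ _ v∈) (∧-conicalˡ _ _ w∈)) (T.+-closed v w (∧-conicalʳ (S v) _ v∈) (∧-conicalʳ (S w) _ w∈))
    ; ·-closed = λ a v v∈ → ∧-intro (S.·-closed a v (∧-conicalˡ _ _ v∈)) (T.·-closed a v (∧-conicalʳ (S v) _ v∈))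
    }
    where
    module S = IsSubspace S-sub
    module T = IsSubspace T-sub

  image-subspace : ∀ {n m} (L : LinearMap n m) {W : Subspace F n} → IsSubspace W → IsSubspace (image L W)
  image-subspace {n} L {W} W-sub = record
    { extensional = λ v w v≗w → anyᵇ-cong (λ u → cong (W u ∧_) (≐ᵛ-congʳ (apply L u) v≗w)) (allVectors F n)
    ; 0∈ = image⇐ L W W.extensional 0ᵛ 0ᵛ W.0∈ (apply-0 L)
    ; +-closed = λ v w v∈ w∈ → +-closed′ (image⇒ L W v v∈) (image⇒ L W w w∈)
    ; ·-closed = λ a v v∈ → ·-closed′ a (image⇒ L W v v∈)
    }
    where
    module W = IsSubspace W-sub
    +-closed′ : ∀ {v w} → Σ (V n) (λ x → W x ≡ true × apply L x ≗ v) → Σ (V n) (λ y → W y ≡ true × apply L y ≗ w) →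
      image L W (v +ᵛ w) ≡ true
    +-closed′ (x , x∈W , Lx≗v) (y , y∈W , Ly≗w) = image⇐ L W W.extensional (x +ᵛ y) _ (W.+-closed x y x∈W y∈W)
      (λ r → trans (apply-+ L x y r) (cong₂ _+_ (Lx≗v r) (Ly≗w r)))
    ·-closed′ : ∀ a {v} → Σ (V n) (λ x → W x ≡ true × apply L x ≗ v) → image L W (a ·ᵛ v) ≡ true
    ·-closed′ a (x , x∈W , Lx≗v) = image⇐ L W W.extensional (a ·ᵛ x) _ (W.·-closed a x x∈W)
      (λ r → trans (apply-· L a x r) (cong (a *_) (Lx≗v r)))

  -- Preimages of a basis of L(W), together with a basis of W ∩ ker L, form a basis of W.
  module RankNullity {n m} {W : Subspace F n} (W-sub : IsSubspace W) (L : LinearMap n m) where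

    module W = IsSubspace W-sub
    image-sub = image-subspace L W-sub
    kernel-sub = ∩-subspace W-sub (kernel-subspace L)
    r = proj₁ (basis-exists image-sub)
    y = proj₁ (proj₂ (basis-exists image-sub))
    y-basis = proj₂ (proj₂ (basis-exists image-sub))
    a = proj₁ (basis-exists kernel-sub)
    z = proj₁ (proj₂ (basis-exists kernel-sub))
    z-basis = proj₂ (proj₂ (basis-exists kernel-sub))
    preimage : ∀ t → Σ (V n) λ v → W v ≡ true × apply L v ≗ y t
    preimage t = image⇒ L W (y t) (Basis.within y-basis t)
    u : Fin r → V n
    u t = proj₁ (preimage t)
    Lu≗y : ∀ t → apply L (u t) ≗ y t
    Lu≗y t = proj₂ (proj₂ (preimage t))
    Lz≗0 : ∀ t → apply L (z t) ≗ 0ᵛ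
    Lz≗0 t = ≐ᵛ⇒ _ _ (∧-conicalʳ (W (z t)) _ (Basis.within z-basis t))
    L-lincomb : ∀ c d → apply L (lincomb u c +ᵛ lincomb z d) ≗ lincomb y c
    L-lincomb c d i = begin
      apply L (lincomb u c +ᵛ lincomb z d) i                               ≡⟨ apply-+ L _ _ i ⟩
      apply L (lincomb u c) i + apply L (lincomb z d) i                     ≡⟨ cong₂ _+_ (apply-lincomb L u c i) (apply-lincomb L z d i) ⟩
      lincomb (λ t → apply L (u t)) c i + lincomb (λ t → apply L (z t)) d i ≡⟨ cong₂ _+_ (lincomb-cong Lu≗y (λ _ → refl) i)
                                                                                        (trans (lincomb-cong Lz≗0 (λ _ → refl) i) (lincomb-of-0 d i)) ⟩
      lincomb y c i + 0#                                                    ≡⟨ +-identityʳ _ ⟩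
      lincomb y c i                                                         ∎
    combined-independent : LinearlyIndependent (u ++ z)
    combined-independent c uz-c≗0 = Fin-+-elim (λ j → c j ≡ 0#) left≡0 right≡0
      where
      left = λ t → c (t ↑ˡ a)
      right = λ t → c (r ↑ʳ t)
      split≗0 : lincomb u left +ᵛ lincomb z right ≗ 0ᵛ
      split≗0 i = trans (sym (lincomb-++ u z c i)) (uz-c≗0 i)
      left≡0 : ∀ t → left t ≡ 0#
      left≡0 = Basis.independent y-basis left (λ i → begin
        lincomb y left i                                   ≡⟨ L-lincomb left right i ⟨
        apply L (lincomb u left +ᵛ lincomb z right) i      ≡⟨ apply-cong L _ 0ᵛ split≗0 i ⟩
        apply L 0ᵛ i                                       ≡⟨ apply-0 L i ⟩
        0#                                                 ∎)
      right≡0 : ∀ t → right t ≡ 0#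
      right≡0 = Basis.independent z-basis right (λ i → begin
        lincomb z right i                       ≡⟨ +-identityˡ _ ⟨
        0# + lincomb z right i                  ≡⟨ cong (_+ lincomb z right i) (trans (lincomb-congʳ u left≡0 i) (lincomb-0 u i)) ⟨
        lincomb u left i + lincomb z right i    ≡⟨ split≗0 i ⟩
        0#                                      ∎)
    combined-spans : Spans W (u ++ z)
    combined-spans v v∈W = (d ++ e) , decomposition
      where
      Lv-spanned = Basis.spans y-basis (apply L v) (image⇐ L W W.extensional v (apply L v) v∈W (λ _ → refl))
      d = proj₁ Lv-spanned
      v′ = v +ᵛ -ᵛ lincomb u d
      Lv′≗0 : apply L v′ ≗ 0ᵛ
      Lv′≗0 i = begin
        apply L v′ i                               ≡⟨ apply-− L v (lincomb u d) i ⟩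
        apply L v i + - apply L (lincomb u d) i    ≡⟨ cong (λ x → apply L v i + - x) (trans (apply-lincomb L u d i) (lincomb-cong Lu≗y (λ _ → refl) i)) ⟩
        apply L v i + - lincomb y d i              ≡⟨ cong (λ x → apply L v i + - x) (proj₂ Lv-spanned i) ⟩
        apply L v i + - apply L v i                ≡⟨ -‿inverseʳ _ ⟩
        0#                                         ∎
      v′∈W : W v′ ≡ true
      v′∈W = -closed W-sub v (lincomb u d) v∈W (lincomb-closed W-sub u (λ t → proj₁ (proj₂ (preimage t))) d)
      v′-spanned = Basis.spans z-basis v′ (∧-intro v′∈W (≐ᵛ⇐ _ _ Lv′≗0))
      e = proj₁ v′-spanned
      decomposition : lincomb (u ++ z) (d ++ e) ≗ v
      decomposition i = begin
        lincomb (u ++ z) (d ++ e) i                 ≡⟨ lincomb-++-split u z d e i ⟩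
        lincomb u d i + lincomb z e i               ≡⟨ cong (lincomb u d i +_) (proj₂ v′-spanned i) ⟩
        lincomb u d i + (v i + - lincomb u d i)     ≡⟨ cong (lincomb u d i +_) (+-comm (v i) _) ⟩
        lincomb u d i + (- lincomb u d i + v i)     ≡⟨ +-assoc _ _ _ ⟨
        lincomb u d i + - lincomb u d i + v i       ≡⟨ cong (_+ v i) (-‿inverseʳ _) ⟩
        0# + v i                                    ≡⟨ +-identityˡ _ ⟩
        v i                                         ∎
    combined-basis : Basis W (u ++ z)
    combined-basis = record
      { within = Fin-+-elim (λ j → W ((u ++ z) j) ≡ true)
          (λ s → trans (cong W (++-↑ˡ u z s)) (proj₁ (proj₂ (preimage s))))
          (λ s → trans (cong W (++-↑ʳ u z s)) (∧-conicalˡ _ _ (Basis.within z-basis s)))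
      ; independent = combined-independent
      ; spans = combined-spans
      }

    rank-nullity : dim F W ≡ dim F (image L W) ℕ.+ dim F (W ∩ˢ kernel L)
    rank-nullity =
      trans (dim-basis W W.extensional (u ++ z) combined-basis)
            (sym (cong₂ ℕ._+_ (dim-basis (image L W) (IsSubspace.extensional image-sub) y y-basis)
                              (dim-basis (W ∩ˢ kernel L) (IsSubspace.extensional kernel-sub) z z-basis)))

  open RankNullity public using (rank-nullity)

  -- With bases s of S and t of T, the map c ↦ lincomb (s ++ t) c has image S + T, and
  -- c ↦ lincomb s (left half of c) maps its kernel isomorphically onto S ∩ T.
  module Grassmann {n} {S T P : Subspace F n} (S-sub : IsSubspace S) (T-sub : IsSubspace T) (P-ext : Extensional P)
    (sum⇒ : ∀ w → P w ≡ true → Σ (V n) λ x → Σ (V n) λ y → S x ≡ true × T y ≡ true × w ≗ x +ᵛ y)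
    (sum⇐ : ∀ x y → S x ≡ true → T y ≡ true → P (x +ᵛ y) ≡ true) where

    module S = IsSubspace S-sub
    module T = IsSubspace T-sub
    a = proj₁ (basis-exists S-sub)
    s = proj₁ (proj₂ (basis-exists S-sub))
    s-basis = proj₂ (proj₂ (basis-exists S-sub))
    b = proj₁ (basis-exists T-sub)
    t = proj₁ (proj₂ (basis-exists T-sub))
    t-basis = proj₂ (proj₂ (basis-exists T-sub))
    full-ab = full (a ℕ.+ b)
    L = lincombMap (s ++ t)
    K = full-ab ∩ˢ kernel L
    K-sub = ∩-subspace (full-subspace (a ℕ.+ b)) (kernel-subspace L)
    left : V (a ℕ.+ b) → V a
    left c i = c (i ↑ˡ b)
    right : V (a ℕ.+ b) → V b
    right c i = c (a ↑ʳ i)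
    M : LinearMap (a ℕ.+ b) n
    M = record
      { apply = λ c → lincomb s (left c)
      ; apply-cong = λ c d c≗d → lincomb-congʳ s (λ i → c≗d (i ↑ˡ b))
      ; apply-+ = λ c d → lincomb-+ s (left c) (left d)
      ; apply-· = λ x c → lincomb-· s x (left c)
      }
    coordinates : ∀ {k} {U : Subspace F n} {u : Fin k → V n} → Basis U u → ∀ v → U v ≡ true → V k
    coordinates u-basis v v∈U = proj₁ (Basis.spans u-basis v v∈U)
    coordinates-spec : ∀ {k} {U : Subspace F n} {u : Fin k → V n} (u-basis : Basis U u) v v∈U →
      lincomb u (coordinates u-basis v v∈U) ≗ v
    coordinates-spec u-basis v v∈U = proj₂ (Basis.spans u-basis v v∈U)

    image≡sum : ∀ w → image L full-ab w ≡ P w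
    image≡sum w = bool-ext image⇒sum sum⇒image
      where
      image⇒sum : image L full-ab w ≡ true → P w ≡ true
      image⇒sum h with image⇒ L full-ab w h
      ... | c , _ , Lc≗w = trans (P-ext w _ (λ r → trans (sym (Lc≗w r)) (lincomb-++ s t c r)))
        (sum⇐ _ _ (lincomb-closed S-sub s (Basis.within s-basis) (left c))
                  (lincomb-closed T-sub t (Basis.within t-basis) (right c)))
      sum⇒image : P w ≡ true → image L full-ab w ≡ true
      sum⇒image w∈P with sum⇒ w w∈P
      ... | x , y , x∈S , y∈T , w≗x+y = image⇐ L full-ab (λ _ _ _ → refl) (cx ++ cy) w refl
        (λ r → trans (lincomb-++-split s t cx cy r)
          (trans (cong₂ _+_ (coordinates-spec s-basis x x∈S r) (coordinates-spec t-basis y y∈T r)) (sym (w≗x+y r))))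
        where
        cx = coordinates s-basis x x∈S
        cy = coordinates t-basis y y∈T

    kernel-trivial : ∀ c → (K ∩ˢ kernel M) c ≡ true → c ≗ 0ᵛ
    kernel-trivial c h = Fin-+-elim (λ j → c j ≡ 0#) (Basis.independent s-basis (left c) Mc≗0)
      (Basis.independent t-basis (right c) (λ r → begin
        lincomb t (right c) r                           ≡⟨ +-identityˡ _ ⟨
        0# + lincomb t (right c) r                      ≡⟨ cong (_+ lincomb t (right c) r) (Mc≗0 r) ⟨
        lincomb s (left c) r + lincomb t (right c) r    ≡⟨ lincomb-++ s t c r ⟨
        lincomb (s ++ t) c r                            ≡⟨ Lc≗0 r ⟩
        0#                                              ∎))
      where
      Lc≗0 : lincomb (s ++ t) c ≗ 0ᵛ
      Lc≗0 = ≐ᵛ⇒ _ _ (∧-conicalʳ true _ (∧-conicalˡ _ _ h))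
      Mc≗0 : lincomb s (left c) ≗ 0ᵛ
      Mc≗0 = ≐ᵛ⇒ _ _ (∧-conicalʳ (K c) _ h)

    image-M≡∩ : ∀ w → image M K w ≡ (S ∩ˢ T) w
    image-M≡∩ w = bool-ext image⇒∩ ∩⇒image
      where
      image⇒∩ : image M K w ≡ true → (S ∩ˢ T) w ≡ true
      image⇒∩ h with image⇒ M K w h
      ... | c , c∈K , Mc≗w = ∧-intro
        (trans (S.extensional w _ (λ r → sym (Mc≗w r))) (lincomb-closed S-sub s (Basis.within s-basis) (left c)))
        (trans (T.extensional w _ (λ r → sym (t-part r))) (lincomb-closed T-sub t (Basis.within t-basis) (-ᵛ right c)))
        where
        t-part : lincomb t (-ᵛ right c) ≗ w
        t-part r = begin
          lincomb t (-ᵛ right c) r  ≡⟨ lincomb-neg t (right c) r ⟩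
          - lincomb t (right c) r   ≡⟨ +-inverseʳ-unique _ _ (trans (+-comm _ _) (trans (sym (lincomb-++ s t c r)) (≐ᵛ⇒ _ _ (∧-conicalʳ true _ c∈K) r))) ⟨
          lincomb s (left c) r      ≡⟨ Mc≗w r ⟩
          w r                       ∎
      ∩⇒image : (S ∩ˢ T) w ≡ true → image M K w ≡ true
      ∩⇒image h = image⇐ M K (IsSubspace.extensional K-sub) (x ++ -ᵛ y) w (∧-intro refl (≐ᵛ⇐ _ _ difference≗0)) Mc≗w
        where
        x = coordinates s-basis w (∧-conicalˡ _ _ h)
        y = coordinates t-basis w (∧-conicalʳ (S w) _ h)
        difference≗0 : lincomb (s ++ t) (x ++ -ᵛ y) ≗ 0ᵛ
        difference≗0 r = begin
          lincomb (s ++ t) (x ++ -ᵛ y) r       ≡⟨ lincomb-++-split s t x (-ᵛ y) r ⟩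
          lincomb s x r + lincomb t (-ᵛ y) r   ≡⟨ cong₂ _+_ (coordinates-spec s-basis w _ r) (lincomb-neg t y r) ⟩
          w r + - lincomb t y r                ≡⟨ cong (λ z → w r + - z) (coordinates-spec t-basis w _ r) ⟩
          w r + - w r                          ≡⟨ -‿inverseʳ _ ⟩
          0#                                   ∎
        Mc≗w : lincomb s (left (x ++ -ᵛ y)) ≗ w
        Mc≗w r = trans (lincomb-congʳ s (++-↑ˡ x (-ᵛ y)) r) (coordinates-spec s-basis w _ r)

    dim-sum+dim-∩ : dim F P ℕ.+ dim F (S ∩ˢ T) ≡ dim F S ℕ.+ dim F T
    dim-sum+dim-∩ = begin
      dim F P ℕ.+ dim F (S ∩ˢ T)                     ≡⟨ cong₂ ℕ._+_ (dim-cong _ _ image≡sum) dim-∩≡dim-K ⟨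
      dim F (image L full-ab) ℕ.+ dim F K            ≡⟨ rank-nullity (full-subspace (a ℕ.+ b)) L ⟨
      dim F full-ab                                  ≡⟨ dim-full (a ℕ.+ b) ⟩
      a ℕ.+ b                                        ≡⟨ cong₂ ℕ._+_ (dim-basis S S.extensional s s-basis) (dim-basis T T.extensional t t-basis) ⟨
      dim F S ℕ.+ dim F T                            ∎
      where
      dim-∩≡dim-K : dim F K ≡ dim F (S ∩ˢ T)
      dim-∩≡dim-K = begin
        dim F K                                              ≡⟨ rank-nullity K-sub M ⟩
        dim F (image M K) ℕ.+ dim F (K ∩ˢ kernel M)          ≡⟨ cong (dim F (image M K) ℕ.+_) (dim-trivial _ kernel-trivial) ⟩
        dim F (image M K) ℕ.+ 0                              ≡⟨ ℕₚ.+-identityʳ _ ⟩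
        dim F (image M K)                                    ≡⟨ dim-cong _ _ image-M≡∩ ⟩
        dim F (S ∩ˢ T)                                       ∎

  open Grassmann public using (dim-sum+dim-∩)

  colSpace : ∀ {m n} → (Fin m → Fin n → Carrier) → Subspace F m
  colSpace {n = n} A = image (matrixMap A) (full n)

  colSpace-subspace : ∀ {m n} (A : Fin m → Fin n → Carrier) → IsSubspace (colSpace A)
  colSpace-subspace {n = n} A = image-subspace (matrixMap A) (full-subspace n)

  colSpace⇐ : ∀ {m n} (A : Fin m → Fin n → Carrier) v w → matVec A v ≗ w → colSpace A w ≡ true
  colSpace⇐ {n = n} A v w Av≗w = image⇐ (matrixMap A) (full n) (λ _ _ _ → refl) v w refl Av≗w

  δ-sym : ∀ {k} (i j : Fin k) → δ i j ≡ δ j i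
  δ-sym i j with i Finₚ.≟ j | j Finₚ.≟ i
  ... | yes _ | yes _ = refl
  ... | no _ | no _ = refl
  ... | yes i≡j | no j≢i = ⊥-elim (j≢i (sym i≡j))
  ... | no i≢j | yes j≡i = ⊥-elim (i≢j (sym j≡i))

  -- The rows of A are combinations of r vectors, where r = dim (colSpace A): expand each column
  -- of A in a basis of the column space and read the coefficients row-wise.
  dim-colSpace-ᵀ≤ : ∀ {m n} (A : Fin m → Fin n → Carrier) → dim F (colSpace (A ᵀ)) ≤ dim F (colSpace A)
  dim-colSpace-ᵀ≤ {m} {n} A = subst (dim F (colSpace (A ᵀ)) ≤_) (sym (dim-basis (colSpace A) (IsSubspace.extensional (colSpace-subspace A)) cb cb-basis))
    (dim≤spanning (colSpace (A ᵀ)) κ κ-spans)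
    where
    r = proj₁ (basis-exists (colSpace-subspace A))
    cb = proj₁ (proj₂ (basis-exists (colSpace-subspace A)))
    cb-basis = proj₂ (proj₂ (basis-exists (colSpace-subspace A)))
    column-spanned : ∀ s → Σ (V r) λ c → lincomb cb c ≗ columns A s
    column-spanned s = Basis.spans cb-basis (columns A s)
      (colSpace⇐ A (unit s) (columns A s) (λ ρ → trans (sum-cong-≗ {n} (λ t → cong (A ρ t *_) (δ-sym s t))) (∑-δ n s (A ρ))))
    κ : Fin r → V n
    κ t s = proj₁ (column-spanned s) t
    row≗ : ∀ ρ → A ρ ≗ lincomb κ (λ t → cb t ρ)
    row≗ ρ s = begin
      A ρ s                                  ≡⟨ proj₂ (column-spanned s) ρ ⟨
      ∑[ t < r ] (κ t s * cb t ρ)            ≡⟨ sum-cong-≗ {r} (λ t → *-comm (κ t s) (cb t ρ)) ⟩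
      ∑[ t < r ] (cb t ρ * κ t s)            ∎
    κ-spans : Spans (colSpace (A ᵀ)) κ
    κ-spans w h with image⇒ (matrixMap (A ᵀ)) (full m) w h
    ... | v , _ , Aᵀv≗w = (λ t → ∑[ ρ < m ] (v ρ * cb t ρ)) , (λ s → begin
      lincomb κ (λ t → ∑[ ρ < m ] (v ρ * cb t ρ)) s   ≡⟨ lincomb-lincomb A κ (λ ρ t → cb t ρ) row≗ v s ⟨
      ∑[ ρ < m ] (v ρ * A ρ s)                        ≡⟨ sum-cong-≗ {m} (λ ρ → *-comm (v ρ) (A ρ s)) ⟩
      matVec (A ᵀ) v s                                ≡⟨ Aᵀv≗w s ⟩
      w s                                             ∎)

  dim-colSpace-ᵀ : ∀ {m n} (A : Fin m → Fin n → Carrier) → dim F (colSpace (A ᵀ)) ≡ dim F (colSpace A)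
  dim-colSpace-ᵀ A = ℕₚ.≤-antisym (dim-colSpace-ᵀ≤ A) (dim-colSpace-ᵀ≤ (A ᵀ))

module Rank (F : FiniteField) where

  open Counting
  open LinearAlgebra F

  open import Data.Nat using (ℕ; _≤_)
  import Data.Nat as ℕ
  import Data.Nat.Properties as ℕₚ
  open import Data.Bool using (Bool; true; _∧_)
  open import Data.Bool.Properties using (∧-conicalˡ; ∧-conicalʳ)
  open import Data.Fin using (Fin)
  open import Data.Product using (Σ; _×_; _,_; proj₁; proj₂)
  open import Data.Vec.Functional using (_++_)
  open import Relation.Binary.PropositionalEquality

  open FiniteField F

  col≡colSpace : ∀ {n} (X : Mat F n) w → col F X w ≡ colSpace X w
  col≡colSpace {n} X w = anyᵇ-cong (λ v → trans (vecEq≡≐ᵛ _ w) (≐ᵛ-congˡ w (mulVec≗matVec X v))) (allVectors F n)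

  rk≡dim-colSpace : ∀ {n} (X : Mat F n) → rk F X ≡ dim F (colSpace X)
  rk≡dim-colSpace X = dim-cong _ _ (col≡colSpace X)

  rk-ᵀ : ∀ {n} (X : Mat F n) → rk F (X ᵀ) ≡ rk F X
  rk-ᵀ X = trans (rk≡dim-colSpace (X ᵀ)) (trans (dim-colSpace-ᵀ X) (sym (rk≡dim-colSpace X)))

  dim-col-∩≡ : ∀ {n} (X Y : Mat F n) → dim F (col F X ∩ˢ col F Y) ≡ dim F (colSpace X ∩ˢ colSpace Y)
  dim-col-∩≡ X Y = dim-cong _ _ (λ w → cong₂ _∧_ (col≡colSpace X w) (col≡colSpace Y w))

  col-cong : ∀ {n} (X Y : Mat F n) → (∀ r s → X r s ≡ Y r s) → ∀ w → col F X w ≡ col F Y w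
  col-cong {n} X Y X≡Y w = begin
    col F X w      ≡⟨ col≡colSpace X w ⟩
    colSpace X w   ≡⟨ anyᵇ-cong (λ v → ≐ᵛ-congˡ w (matVec-cong X≡Y v)) (allVectors F n) ⟩
    colSpace Y w   ≡⟨ col≡colSpace Y w ⟨
    col F Y w      ∎
    where open ≡-Reasoning

  rk-cong : ∀ {n} (X Y : Mat F n) → (∀ r s → X r s ≡ Y r s) → rk F X ≡ rk F Y
  rk-cong X Y X≡Y = dim-cong _ _ (col-cong X Y X≡Y)

  -- ker (X − Y) ∩ ker X embeds in ker [X; Y], and X maps ker (X − Y) into col X ∩ col Y;
  -- comparing the two rank–nullity counts with Grassmann's formula for the row spaces gives the bound.
  module RankInequality {n : ℕ} (X Y : Mat F n) where

    Z = _-ᴹ_ F X Y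
    X∸Y = matrixMap Z
    KZ = full n ∩ˢ kernel X∸Y
    KZ-sub = ∩-subspace (full-subspace n) (kernel-subspace X∸Y)
    stacked : Fin (n ℕ.+ n) → Fin n → Carrier
    stacked = X ++ Y
    Kstacked = full n ∩ˢ kernel (matrixMap stacked)
    Kstacked-sub = ∩-subspace (full-subspace n) (kernel-subspace (matrixMap stacked))
    common-col = colSpace X ∩ˢ colSpace Y
    common-row = colSpace (X ᵀ) ∩ˢ colSpace (Y ᵀ)

    z = dim F (colSpace Z)
    cc = dim F common-col
    cr = dim F common-row
    s = dim F (colSpace stacked)
    ks = dim F Kstacked
    p = dim F (image (matrixMap X) KZ)
    q = dim F (KZ ∩ˢ kernel (matrixMap X))

    n≡z+dim-KZ : n ≡ z ℕ.+ dim F KZ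
    n≡z+dim-KZ = trans (sym (dim-full n)) (rank-nullity (full-subspace n) X∸Y)

    n≡s+ks : n ≡ s ℕ.+ ks
    n≡s+ks = trans (sym (dim-full n)) (rank-nullity (full-subspace n) (matrixMap stacked))

    p≤cc : p ≤ cc
    p≤cc = dim-mono _ common-col (IsSubspace.extensional (∩-subspace (colSpace-subspace X) (colSpace-subspace Y))) X-image⊆
      where
      X-image⊆ : ∀ w → image (matrixMap X) KZ w ≡ true → common-col w ≡ true
      X-image⊆ w h with image⇒ (matrixMap X) KZ w h
      ... | v , v∈KZ , Xv≗w = ∧-intro (colSpace⇐ X v w Xv≗w)
        (colSpace⇐ Y v w (λ r → trans (sym (matVec-−≗0 X Y v (≐ᵛ⇒ _ _ (∧-conicalʳ true _ v∈KZ)) r)) (Xv≗w r)))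

    q≤ks : q ≤ ks
    q≤ks = dim-mono _ Kstacked (IsSubspace.extensional Kstacked-sub) kernels⊆
      where
      kernels⊆ : ∀ v → (KZ ∩ˢ kernel (matrixMap X)) v ≡ true → Kstacked v ≡ true
      kernels⊆ v h = ≐ᵛ⇐ _ _ (Fin-+-elim (λ j → matVec stacked v j ≡ 0#)
          (λ i → trans (proj₁ (matVec-++ X Y v) i) (Xv≗0 i))
          (λ i → trans (proj₂ (matVec-++ X Y v) i) (trans (sym (Xv≗Yv i)) (Xv≗0 i))))
        where
        Xv≗0 : matVec X v ≗ 0ᵛ
        Xv≗0 = ≐ᵛ⇒ _ _ (∧-conicalʳ (KZ v) _ h)
        Xv≗Yv : matVec X v ≗ matVec Y v
        Xv≗Yv = matVec-−≗0 X Y v (≐ᵛ⇒ _ _ (∧-conicalʳ true _ (∧-conicalˡ _ _ h)))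

    rows-grassmann : dim F (colSpace (stacked ᵀ)) ℕ.+ cr ≡ dim F (colSpace (X ᵀ)) ℕ.+ dim F (colSpace (Y ᵀ))
    rows-grassmann = dim-sum+dim-∩ (colSpace-subspace (X ᵀ)) (colSpace-subspace (Y ᵀ))
      (IsSubspace.extensional (colSpace-subspace (stacked ᵀ))) sum⇒ sum⇐
      where
      sum⇒ : ∀ w → colSpace (stacked ᵀ) w ≡ true → Σ (V n) λ x → Σ (V n) λ y →
        colSpace (X ᵀ) x ≡ true × colSpace (Y ᵀ) y ≡ true × w ≗ x +ᵛ y
      sum⇒ w h with image⇒ (matrixMap (stacked ᵀ)) (full (n ℕ.+ n)) w h
      ... | c , _ , stackedᵀc≗w = _ , _ , colSpace⇐ (X ᵀ) _ _ (λ _ → refl) , colSpace⇐ (Y ᵀ) _ _ (λ _ → refl) ,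
        (λ i → trans (sym (stackedᵀc≗w i)) (matVec-++ᵀ X Y c i))
      sum⇐ : ∀ x y → colSpace (X ᵀ) x ≡ true → colSpace (Y ᵀ) y ≡ true → colSpace (stacked ᵀ) (x +ᵛ y) ≡ true
      sum⇐ x y x∈ y∈ with image⇒ (matrixMap (X ᵀ)) (full n) x x∈ | image⇒ (matrixMap (Y ᵀ)) (full n) y y∈
      ... | cx , _ , Xᵀcx≗x | cy , _ , Yᵀcy≗y = colSpace⇐ (stacked ᵀ) (cx ++ cy) _ (λ i →
        trans (matVec-++ᵀ X Y (cx ++ cy) i)
              (cong₂ _+_ (trans (apply-cong (matrixMap (X ᵀ)) _ cx (++-↑ˡ cx cy) i) (Xᵀcx≗x i))
                         (trans (apply-cong (matrixMap (Y ᵀ)) _ cy (++-↑ʳ cx cy) i) (Yᵀcy≗y i))))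

    s≤z+cc : s ≤ z ℕ.+ cc
    s≤z+cc = ℕₚ.+-cancelʳ-≤ ks s (z ℕ.+ cc) (begin
      s ℕ.+ ks              ≡⟨ n≡s+ks ⟨
      n                     ≡⟨ n≡z+dim-KZ ⟩
      z ℕ.+ dim F KZ        ≡⟨ cong (z ℕ.+_) (rank-nullity KZ-sub (matrixMap X)) ⟩
      z ℕ.+ (p ℕ.+ q)       ≤⟨ ℕₚ.+-monoʳ-≤ z (ℕₚ.+-mono-≤ p≤cc q≤ks) ⟩
      z ℕ.+ (cc ℕ.+ ks)     ≡⟨ ℕₚ.+-assoc z cc ks ⟨
      z ℕ.+ cc ℕ.+ ks       ∎)
      where open ℕₚ.≤-Reasoning

    rank-inequality : dim F (colSpace X) ℕ.+ dim F (colSpace Y) ≤ dim F (colSpace Z) ℕ.+ dim F common-col ℕ.+ dim F common-row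
    rank-inequality = begin
      dim F (colSpace X) ℕ.+ dim F (colSpace Y)               ≡⟨ cong₂ ℕ._+_ (dim-colSpace-ᵀ X) (dim-colSpace-ᵀ Y) ⟨
      dim F (colSpace (X ᵀ)) ℕ.+ dim F (colSpace (Y ᵀ))       ≡⟨ rows-grassmann ⟨
      dim F (colSpace (stacked ᵀ)) ℕ.+ cr                     ≡⟨ cong (ℕ._+ cr) (dim-colSpace-ᵀ stacked) ⟩
      s ℕ.+ cr                                                ≤⟨ ℕₚ.+-monoˡ-≤ cr s≤z+cc ⟩
      z ℕ.+ cc ℕ.+ cr                                         ∎
      where open ℕₚ.≤-Reasoning

  rk-sub-inequality : ∀ {n} (X Y : Mat F n) →
    rk F X ℕ.+ rk F Y ≤ rk F (_-ᴹ_ F X Y) ℕ.+ dim F (col F X ∩ˢ col F Y) ℕ.+ dim F (col F (X ᵀ) ∩ˢ col F (Y ᵀ))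
  rk-sub-inequality X Y = subst₂ _≤_
    (sym (cong₂ ℕ._+_ (rk≡dim-colSpace X) (rk≡dim-colSpace Y)))
    (sym (cong₂ ℕ._+_ (cong₂ ℕ._+_ (rk≡dim-colSpace (_-ᴹ_ F X Y)) (dim-col-∩≡ X Y)) (dim-col-∩≡ (X ᵀ) (Y ᵀ))))
    (RankInequality.rank-inequality X Y)

  dim-col-∩≤rk : ∀ {n} (X Y : Mat F n) → dim F (col F X ∩ˢ col F Y) ≤ rk F Y
  dim-col-∩≤rk X Y = dim-mono _ (col F Y) col-extensional (λ v v∈ → ∧-conicalʳ (col F X v) _ v∈)
    where
    col-extensional : Extensional (col F Y)
    col-extensional v w v≗w = trans (col≡colSpace Y v)
      (trans (IsSubspace.extensional (colSpace-subspace Y) v w v≗w) (sym (col≡colSpace Y w)))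

  rk-common-respects : ∀ {n} (X : Mat F n) (P : ℕ → ℕ → Bool) →
    Respects (matrixSetoid n) (λ Y → P (rk F Y) (dim F (col F X ∩ˢ col F Y)))
  rk-common-respects X P Y Y′ Y≐Y′ = cong₂ P (rk-cong Y Y′ (≐ᴹ⇒ Y Y′ Y≐Y′))
    (dim-cong _ _ (λ w → cong (col F X w ∧_) (col-cong Y Y′ (≐ᴹ⇒ Y Y′ Y≐Y′) w)))

  ᵀ-adjoint : ∀ {n} (Y Z : Mat F n) → (Y ᵀ ≐ᴹ Z) ≡ (Y ≐ᴹ Z ᵀ)
  ᵀ-adjoint Y Z = bool-ext (λ h → ≐ᴹ⇐ Y (Z ᵀ) (λ r s → ≐ᴹ⇒ (Y ᵀ) Z h s r))
                           (λ h → ≐ᴹ⇐ (Y ᵀ) Z (λ r s → ≐ᴹ⇒ Y (Z ᵀ) h s r))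

module Invariance (F : FiniteField) where

  open Counting
  open LinearAlgebra F
  open Rank F

  open import Data.Nat using (ℕ; _≤_)
  import Data.Nat as ℕ
  import Data.Nat.Properties as ℕₚ
  open import Data.Bool using (Bool; true; _∧_)
  open import Data.Fin using (Fin)
  open import Data.Product using (_,_; proj₁; proj₂)
  open import Data.Vec.Functional using (_++_)
  open import Relation.Binary.PropositionalEquality
  open import Algebra.Structures using (IsCommutativeRing)

  open FiniteField F
  open IsCommutativeRing isCommutativeRing using (+-identityˡ)

  record LinearAutomorphism (n : ℕ) : Set where
    field
      to from : LinearMap n n
      from-to : ∀ v → apply from (apply to v) ≗ v
      to-from : ∀ v → apply to (apply from v) ≗ v

  open LinearAutomorphism

  infix 8 _⁻¹

  _⁻¹ : ∀ {n} → LinearAutomorphism n → LinearAutomorphism n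
  A ⁻¹ = record { to = from A ; from = to A ; from-to = to-from A ; to-from = from-to A }

  dim≤dim-preimage : ∀ {n} (A : LinearAutomorphism n) (W : Subspace F n) → Extensional W →
    dim F W ≤ dim F (λ w → W (apply (from A) w))
  dim≤dim-preimage A W W-ext with dim-witness W
  ... | vs , vs∈W , vs-indep = independent≤dim _ (λ v w v≗w → W-ext _ _ (apply-cong (from A) v w v≗w))
    (λ t → apply (to A) (vs t)) (λ t → trans (W-ext _ _ (from-to A (vs t))) (vs∈W t))
    (λ c Avs-c≗0 → vs-indep c (λ r → begin
      lincomb vs c r                                         ≡⟨ from-to A (lincomb vs c) r ⟨
      apply (from A) (apply (to A) (lincomb vs c)) r         ≡⟨ apply-cong (from A) _ _ (λ i → trans (apply-lincomb (to A) vs c i) (Avs-c≗0 i)) r ⟩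
      apply (from A) 0ᵛ r                                    ≡⟨ apply-0 (from A) r ⟩
      0#                                                     ∎))
    where open ≡-Reasoning

  dim-preimage : ∀ {n} (A : LinearAutomorphism n) (W : Subspace F n) → Extensional W →
    dim F (λ w → W (apply (from A) w)) ≡ dim F W
  dim-preimage A W W-ext = ℕₚ.≤-antisym
    (subst (dim F preimage ≤_) (dim-cong _ _ (λ v → W-ext _ _ (from-to A v)))
      (dim≤dim-preimage (A ⁻¹) preimage (λ v w v≗w → W-ext _ _ (apply-cong (from A) v w v≗w))))
    (dim≤dim-preimage A W W-ext)
    where
    preimage : Subspace F _
    preimage w = W (apply (from A) w)

  infixr 7 _⊙_

  _⊙_ : ∀ {n} → LinearMap n n → Mat F n → Mat F n
  (L ⊙ Y) r s = apply L (λ ρ → Y ρ s) r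

  matVec-⊙ : ∀ {n} (L : LinearMap n n) (Y : Mat F n) v → matVec (L ⊙ Y) v ≗ apply L (matVec Y v)
  matVec-⊙ L Y v r = begin
    matVec (L ⊙ Y) v r                                 ≡⟨ matVec≗lincomb-columns (L ⊙ Y) v r ⟩
    lincomb (λ s → apply L (columns Y s)) v r          ≡⟨ apply-lincomb L (columns Y) v r ⟨
    apply L (lincomb (columns Y) v) r                  ≡⟨ apply-cong L _ _ (matVec≗lincomb-columns Y v) r ⟨
    apply L (matVec Y v) r                             ∎
    where open ≡-Reasoning

  colSpace-⊙ : ∀ {n} (A : LinearAutomorphism n) (Y : Mat F n) w → colSpace (to A ⊙ Y) w ≡ colSpace Y (apply (from A) w)
  colSpace-⊙ {n} A Y w = bool-ext ⊙⇒ ⊙⇐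
    where
    ⊙⇒ : colSpace (to A ⊙ Y) w ≡ true → colSpace Y (apply (from A) w) ≡ true
    ⊙⇒ h with image⇒ (matrixMap (to A ⊙ Y)) (full n) w h
    ... | v , _ , AYv≗w = colSpace⇐ Y v _ (λ r → trans (sym (from-to A (matVec Y v) r))
            (apply-cong (from A) _ _ (λ i → trans (sym (matVec-⊙ (to A) Y v i)) (AYv≗w i)) r))
    ⊙⇐ : colSpace Y (apply (from A) w) ≡ true → colSpace (to A ⊙ Y) w ≡ true
    ⊙⇐ h with image⇒ (matrixMap Y) (full n) _ h
    ... | v , _ , Yv≗A⁻¹w = colSpace⇐ (to A ⊙ Y) v w
            (λ r → trans (matVec-⊙ (to A) Y v r) (trans (apply-cong (to A) _ _ Yv≗A⁻¹w r) (to-from A w r)))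

  Q-predicate : ∀ {n} → Mat F n → ℕ → ℕ → Mat F n → Bool
  Q-predicate X j c Y = (_=ℕ_ F (rk F Y) j) ∧ (_=ℕ_ F (dim F (col F X ∩ˢ col F Y)) c)

  Q-predicate-respects : ∀ {n} (X : Mat F n) j c → Respects (matrixSetoid n) (Q-predicate X j c)
  Q-predicate-respects X j c = rk-common-respects X (λ r d → (_=ℕ_ F r j) ∧ (_=ℕ_ F d c))

  -- Y ↦ A ⊙ Y permutes the matrices, preserves rank and turns col X′ ∩ col Y into col X ∩ col (A ⊙ Y).
  Qcount-transport : ∀ {n} (A : LinearAutomorphism n) (X X′ : Mat F n) →
    (∀ w → colSpace X w ≡ colSpace X′ (apply (from A) w)) → ∀ j c → Qcount F n X j c ≡ Qcount F n X′ j c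
  Qcount-transport {n} A X X′ cols j c = begin
    Qcount F n X j c                                  ≡⟨ count≡tally (Q-predicate X j c) (allMats F n) ⟩
    tally (Q-predicate X j c) (allMats F n)           ≡⟨ tally-∘-bijection (matrixSetoid n) (allMats F n) (allMats-enumerate n) (to A ⊙_) (from A ⊙_)
                                                           adjoint (Q-predicate X j c) (Q-predicate-respects X j c) ⟩
    tally (λ Y → Q-predicate X j c (to A ⊙ Y)) (allMats F n) ≡⟨ tally-cong (λ Y → cong₂ (λ r d → (_=ℕ_ F r j) ∧ (_=ℕ_ F d c)) (rk-⊙ Y) (common-⊙ Y)) (allMats F n) ⟩
    tally (Q-predicate X′ j c) (allMats F n)          ≡⟨ count≡tally (Q-predicate X′ j c) (allMats F n) ⟨
    Qcount F n X′ j c                                 ∎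
    where
    open ≡-Reasoning
    adjoint : ∀ Y Z → (to A ⊙ Y ≐ᴹ Z) ≡ (Y ≐ᴹ from A ⊙ Z)
    adjoint Y Z = bool-ext
      (λ h → ≐ᴹ⇐ Y (from A ⊙ Z) (λ r s → trans (sym (from-to A (columns Y s) r)) (apply-cong (from A) _ _ (λ ρ → ≐ᴹ⇒ (to A ⊙ Y) Z h ρ s) r)))
      (λ h → ≐ᴹ⇐ (to A ⊙ Y) Z (λ r s → trans (apply-cong (to A) _ _ (λ ρ → ≐ᴹ⇒ Y (from A ⊙ Z) h ρ s) r) (to-from A (columns Z s) r)))
    rk-⊙ : ∀ Y → rk F (to A ⊙ Y) ≡ rk F Y
    rk-⊙ Y = begin
      rk F (to A ⊙ Y)                                   ≡⟨ rk≡dim-colSpace (to A ⊙ Y) ⟩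
      dim F (colSpace (to A ⊙ Y))                       ≡⟨ dim-cong _ _ (colSpace-⊙ A Y) ⟩
      dim F (λ w → colSpace Y (apply (from A) w))       ≡⟨ dim-preimage A (colSpace Y) (IsSubspace.extensional (colSpace-subspace Y)) ⟩
      dim F (colSpace Y)                                ≡⟨ rk≡dim-colSpace Y ⟨
      rk F Y                                            ∎
    common-⊙ : ∀ Y → dim F (col F X ∩ˢ col F (to A ⊙ Y)) ≡ dim F (col F X′ ∩ˢ col F Y)
    common-⊙ Y = begin
      dim F (col F X ∩ˢ col F (to A ⊙ Y))                               ≡⟨ dim-col-∩≡ X (to A ⊙ Y) ⟩
      dim F (colSpace X ∩ˢ colSpace (to A ⊙ Y))                         ≡⟨ dim-cong _ _ (λ w → cong₂ _∧_ (cols w) (colSpace-⊙ A Y w)) ⟩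
      dim F (λ w → (colSpace X′ ∩ˢ colSpace Y) (apply (from A) w))      ≡⟨ dim-preimage A _ (IsSubspace.extensional (∩-subspace (colSpace-subspace X′) (colSpace-subspace Y))) ⟩
      dim F (colSpace X′ ∩ˢ colSpace Y)                                 ≡⟨ dim-col-∩≡ X′ Y ⟨
      dim F (col F X′ ∩ˢ col F Y)                                       ∎

  module _ {n N : ℕ} {b : Fin N → V n} (b-basis : Basis (full n) b) where

    coordinates : V n → V N
    coordinates v = proj₁ (Basis.spans b-basis v refl)

    coordinates-spec : ∀ v → lincomb b (coordinates v) ≗ v
    coordinates-spec v = proj₂ (Basis.spans b-basis v refl)

    coordinates-unique : ∀ c v → lincomb b c ≗ v → c ≗ coordinates v
    coordinates-unique c v bc≗v = lincomb-injective b (Basis.independent b-basis) c (coordinates v)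
      (λ r → trans (bc≗v r) (sym (coordinates-spec v r)))

    recombine : (Fin N → V n) → LinearMap n n
    recombine b′ = record
      { apply = λ v → lincomb b′ (coordinates v)
      ; apply-cong = λ v w v≗w → lincomb-congʳ b′ (coordinates-unique (coordinates v) w (λ r → trans (coordinates-spec v r) (v≗w r)))
      ; apply-+ = λ v w r → trans (lincomb-congʳ b′ (λ t → sym (coordinates-unique _ _ (+-spec v w) t)) r) (lincomb-+ b′ (coordinates v) (coordinates w) r)
      ; apply-· = λ a v r → trans (lincomb-congʳ b′ (λ t → sym (coordinates-unique _ _ (·-spec a v) t)) r) (lincomb-· b′ a (coordinates v) r)
      }
      where
      +-spec : ∀ v w → lincomb b (coordinates v +ᵛ coordinates w) ≗ v +ᵛ w
      +-spec v w r = trans (lincomb-+ b (coordinates v) (coordinates w) r) (cong₂ _+_ (coordinates-spec v r) (coordinates-spec w r))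
      ·-spec : ∀ a v → lincomb b (a ·ᵛ coordinates v) ≗ a ·ᵛ v
      ·-spec a v r = trans (lincomb-· b a (coordinates v) r) (cong (a *_) (coordinates-spec v r))

    recombine-lincomb : ∀ (b′ : Fin N → V n) c → apply (recombine b′) (lincomb b c) ≗ lincomb b′ c
    recombine-lincomb b′ c = lincomb-congʳ b′ (λ t → sym (coordinates-unique c (lincomb b c) (λ _ → refl) t))

  basis-automorphism : ∀ {n N} {b b′ : Fin N → V n} → Basis (full n) b → Basis (full n) b′ → LinearAutomorphism n
  basis-automorphism {b = b} {b′} b-basis b′-basis = record
    { to = recombine b′-basis b
    ; from = recombine b-basis b′
    ; from-to = λ v r → trans (recombine-lincomb b-basis b′ (coordinates b′-basis v) r) (coordinates-spec b′-basis v r)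
    ; to-from = λ v r → trans (recombine-lincomb b′-basis b (coordinates b-basis v) r) (coordinates-spec b-basis v r)
    }

  lincomb-padded : ∀ {n e p} (w : Fin e → V n) (u : Fin p → V n) d → lincomb (w ++ u) (0ᵛ ++ d) ≗ lincomb u d
  lincomb-padded w u d r = trans (lincomb-++-split w u 0ᵛ d r) (trans (cong (_+ lincomb u d r) (lincomb-0 w r)) (+-identityˡ _))

  -- Extending bases u of col X and u′ of col X′ to bases w ++ u and w′ ++ u′ of F^n, the
  -- automorphism sending w′ ++ u′ to w ++ u carries col X′ onto col X.
  cols-aligned : ∀ {n e p} (X X′ : Mat F n) {w w′ : Fin e → V n} {u u′ : Fin p → V n} →
    Basis (colSpace X) u → Basis (colSpace X′) u′ →
    (wu-basis : Basis (full n) (w ++ u)) (wu′-basis : Basis (full n) (w′ ++ u′)) →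
    ∀ v → colSpace X v ≡ colSpace X′ (apply (from (basis-automorphism wu-basis wu′-basis)) v)
  cols-aligned X X′ {w} {w′} {u} {u′} u-basis u′-basis wu-basis wu′-basis v = bool-ext
    (λ v∈X → moves u-basis u′-basis (from A) from-span v v∈X)
    (λ A⁻¹v∈X′ → trans (IsSubspace.extensional (colSpace-subspace X) v _ (λ r → sym (to-from A v r)))
                        (moves u′-basis u-basis (to A) to-span _ A⁻¹v∈X′))
    where
    A = basis-automorphism wu-basis wu′-basis
    to-span : ∀ d → apply (to A) (lincomb u′ d) ≗ lincomb u d
    to-span d r = begin
      apply (to A) (lincomb u′ d) r                ≡⟨ apply-cong (to A) _ _ (λ i → sym (lincomb-padded w′ u′ d i)) r ⟩
      apply (to A) (lincomb (w′ ++ u′) (0ᵛ ++ d)) r ≡⟨ recombine-lincomb wu′-basis (w ++ u) (0ᵛ ++ d) r ⟩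
      lincomb (w ++ u) (0ᵛ ++ d) r                 ≡⟨ lincomb-padded w u d r ⟩
      lincomb u d r                                ∎
      where open ≡-Reasoning
    from-span : ∀ d → apply (from A) (lincomb u d) ≗ lincomb u′ d
    from-span d r = begin
      apply (from A) (lincomb u d) r                ≡⟨ apply-cong (from A) _ _ (λ i → sym (lincomb-padded w u d i)) r ⟩
      apply (from A) (lincomb (w ++ u) (0ᵛ ++ d)) r ≡⟨ recombine-lincomb wu-basis (w′ ++ u′) (0ᵛ ++ d) r ⟩
      lincomb (w′ ++ u′) (0ᵛ ++ d) r                ≡⟨ lincomb-padded w′ u′ d r ⟩
      lincomb u′ d r                                ∎
      where open ≡-Reasoning
    moves : ∀ {Y Y′ : Mat F _} {s s′ : Fin _ → V _} → Basis (colSpace Y) s → Basis (colSpace Y′) s′ → (L : LinearMap _ _) →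
      (∀ d → apply L (lincomb s d) ≗ lincomb s′ d) → ∀ x → colSpace Y x ≡ true → colSpace Y′ (apply L x) ≡ true
    moves {Y} {Y′} {s} {s′} s-basis s′-basis L L-span x x∈Y with Basis.spans s-basis x x∈Y
    ... | d , sd≗x = trans (IsSubspace.extensional (colSpace-subspace Y′) _ _ (λ r → trans (apply-cong L _ _ (λ i → sym (sd≗x i)) r) (L-span d r)))
                           (lincomb-closed (colSpace-subspace Y′) s′ (Basis.within s′-basis) d)

  Qcount-invariant : ∀ {n} (X X′ : Mat F n) → rk F X ≡ rk F X′ → ∀ j c → Qcount F n X j c ≡ Qcount F n X′ j c
  Qcount-invariant {n} X X′ rk≡ j c
    with basis-exists (colSpace-subspace X) | basis-exists (colSpace-subspace X′)
  ... | p , u , u-basis | p′ , u′ , u′-basis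
    with basis-extension (full-subspace n) u (λ _ → refl) (Basis.independent u-basis)
       | basis-extension (full-subspace n) u′ (λ _ → refl) (Basis.independent u′-basis)
  ... | e , w , wu-basis | e′ , w′ , wu′-basis = same-sizes p≡p′ e≡e′ u′ u′-basis w′ wu′-basis
    where
    dim-full-basis : ∀ {k} {b : Fin k → V n} → Basis (full n) b → n ≡ k
    dim-full-basis b-basis = trans (sym (dim-full n)) (dim-basis (full n) (λ _ _ _ → refl) _ b-basis)
    dim-col-basis : ∀ {k} (Y : Mat F n) {b : Fin k → V n} → Basis (colSpace Y) b → rk F Y ≡ k
    dim-col-basis Y b-basis = trans (rk≡dim-colSpace Y) (dim-basis _ (IsSubspace.extensional (colSpace-subspace Y)) _ b-basis)
    p≡p′ : p ≡ p′
    p≡p′ = trans (sym (dim-col-basis X u-basis)) (trans rk≡ (dim-col-basis X′ u′-basis))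
    e≡e′ : e ≡ e′
    e≡e′ = ℕₚ.+-cancelʳ-≡ p e e′ (trans (sym (dim-full-basis wu-basis)) (trans (dim-full-basis wu′-basis) (cong (e′ ℕ.+_) (sym p≡p′))))
    same-sizes : ∀ {p″ e″} → p ≡ p″ → e ≡ e″ → (u″ : Fin p″ → V n) → Basis (colSpace X′) u″ →
      (w″ : Fin e″ → V n) → Basis (full n) (w″ ++ u″) → Qcount F n X j c ≡ Qcount F n X′ j c
    same-sizes refl refl u″ u″-basis w″ wu″-basis = Qcount-transport (basis-automorphism wu-basis wu″-basis) X X′
      (cols-aligned X X′ u-basis u″-basis wu-basis wu″-basis) j c

module Bound (F : FiniteField) where

  open Counting
  open LinearAlgebra F
  open Rank F
  open Invariance F

  open import Data.Nat using (ℕ; _+_; _*_; _∸_; _≤_)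
  import Data.Nat.Properties as ℕₚ
  open import Data.Bool using (Bool; true; _∧_)
  open import Data.Bool.Properties using (∧-conicalˡ; ∧-conicalʳ)
  open import Data.List using (cartesianProduct)
  open import Data.Product using (proj₁; proj₂)
  open import Data.Sum using (_⊎_; inj₁; inj₂)
  open import Relation.Nullary using (does)
  open import Relation.Nullary.Decidable using (dec-true)
  open import Relation.Binary.PropositionalEquality

  module _ {n : ℕ} (i j k : ℕ) (X : Mat F n) (rkX≡i : rk F X ≡ i) where

    lo = ceilHalf (i + j ∸ k)
    S = sumFromTo lo j (λ c → Qcount F n X j c)

    close : Mat F n → Mat F n → Bool
    close X′ Y = (_=ℕ_ F (rk F Y) j) ∧ (_≤ℕ_ F (rk F (_-ᴹ_ F X′ Y)) k)

    in-range : ℕ → Bool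
    in-range d = does (lo ℕₚ.≤? d) ∧ does (d ℕₚ.≤? j)

    rank-j-in-range : Mat F n → Mat F n → Bool
    rank-j-in-range X′ Y = (_=ℕ_ F (rk F Y) j) ∧ in-range (dim F (col F X′ ∩ˢ col F Y))

    rank-j-in-range≤S : ∀ (X′ : Mat F n) → rk F X′ ≡ i → tally (rank-j-in-range X′) (allMats F n) ≤ S
    rank-j-in-range≤S X′ rkX′≡i = subst (tally (rank-j-in-range X′) (allMats F n) ≤_)
      (sumFromTo-cong lo j (λ c → Qcount-invariant X′ X (trans rkX′≡i (sym rkX≡i)) j c))
      (tally-sumFromTo lo j (λ Y → _=ℕ_ F (rk F Y) j) (λ Y → dim F (col F X′ ∩ˢ col F Y)) (allMats F n))

    close⇒in-range : ∀ X′ → rk F X′ ≡ i → ∀ Y → close X′ Y ≡ true →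
      rank-j-in-range X′ Y ≡ true ⊎ rank-j-in-range (X′ ᵀ) (Y ᵀ) ≡ true
    close⇒in-range X′ rkX′≡i Y h = pick (ceilHalf≤⊎ (i + j ∸ k) cc cr i+j∸k≤cc+cr)
      where
      rkY=j = ∧-conicalˡ _ _ h
      rkY≡j : rk F Y ≡ j
      rkY≡j = does⇒ (rk F Y ℕₚ.≟ j) rkY=j
      cc = dim F (col F X′ ∩ˢ col F Y)
      cr = dim F (col F (X′ ᵀ) ∩ˢ col F (Y ᵀ))
      cc≤j : cc ≤ j
      cc≤j = subst (cc ≤_) rkY≡j (dim-col-∩≤rk X′ Y)
      cr≤j : cr ≤ j
      cr≤j = subst (cr ≤_) (trans (rk-ᵀ Y) rkY≡j) (dim-col-∩≤rk (X′ ᵀ) (Y ᵀ))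
      i+j∸k≤cc+cr : i + j ∸ k ≤ cc + cr
      i+j∸k≤cc+cr = ℕₚ.m≤n+o⇒m∸n≤o (i + j) k (begin
        i + j                                   ≡⟨ cong₂ _+_ rkX′≡i rkY≡j ⟨
        rk F X′ + rk F Y                        ≤⟨ rk-sub-inequality X′ Y ⟩
        rk F (_-ᴹ_ F X′ Y) + cc + cr            ≤⟨ ℕₚ.+-monoˡ-≤ cr (ℕₚ.+-monoˡ-≤ cc (does⇒ (_ ℕₚ.≤? k) (∧-conicalʳ (_=ℕ_ F (rk F Y) j) _ h))) ⟩
        k + cc + cr                             ≡⟨ ℕₚ.+-assoc k cc cr ⟩
        k + (cc + cr)                           ∎)
        where open ℕₚ.≤-Reasoning
      pick : lo ≤ cc ⊎ lo ≤ cr → rank-j-in-range X′ Y ≡ true ⊎ rank-j-in-range (X′ ᵀ) (Y ᵀ) ≡ true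
      pick (inj₁ lo≤cc) = inj₁ (∧-intro rkY=j (∧-intro (dec-true (lo ℕₚ.≤? cc) lo≤cc) (dec-true (cc ℕₚ.≤? j) cc≤j)))
      pick (inj₂ lo≤cr) = inj₂ (∧-intro (dec-true (rk F (Y ᵀ) ℕₚ.≟ j) (trans (rk-ᵀ Y) rkY≡j)) (∧-intro (dec-true (lo ℕₚ.≤? cr) lo≤cr) (dec-true (cr ℕₚ.≤? j) cr≤j)))

    close-count≤2S : ∀ X′ → rk F X′ ≡ i → tally (close X′) (allMats F n) ≤ 2 * S
    close-count≤2S X′ rkX′≡i = begin
      tally (close X′) (allMats F n)                                   ≤⟨ tally-≤-+ (close⇒in-range X′ rkX′≡i) (allMats F n) ⟩
      tally (rank-j-in-range X′) (allMats F n)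
        + tally (λ Y → rank-j-in-range (X′ ᵀ) (Y ᵀ)) (allMats F n)     ≡⟨ cong (tally (rank-j-in-range X′) (allMats F n) +_) transpose ⟨
      tally (rank-j-in-range X′) (allMats F n)
        + tally (rank-j-in-range (X′ ᵀ)) (allMats F n)                 ≤⟨ ℕₚ.+-mono-≤ (rank-j-in-range≤S X′ rkX′≡i) (rank-j-in-range≤S (X′ ᵀ) (trans (rk-ᵀ X′) rkX′≡i)) ⟩
      S + S                                                    ≡⟨ cong (S +_) (ℕₚ.+-identityʳ S) ⟨
      2 * S                                                    ∎
      where
      open ℕₚ.≤-Reasoning
      transpose : tally (rank-j-in-range (X′ ᵀ)) (allMats F n) ≡ tally (λ Y → rank-j-in-range (X′ ᵀ) (Y ᵀ)) (allMats F n)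
      transpose = tally-∘-bijection (matrixSetoid n) (allMats F n) (allMats-enumerate n) _ᵀ _ᵀ ᵀ-adjoint
        (rank-j-in-range (X′ ᵀ)) (rk-common-respects (X′ ᵀ) (λ r d → (_=ℕ_ F r j) ∧ in-range d))

    bound : Pcount F n i j k ≤ Mcount F n i * (2 * S)
    bound = begin
      Pcount F n i j k                                              ≡⟨ count≡tally _ (cartesianProduct (allMats F n) (allMats F n)) ⟩
      sumBy (λ XY → indicator (rank-i-close (proj₁ XY) (proj₂ XY)))
            (cartesianProduct (allMats F n) (allMats F n))                          ≡⟨ sumBy-cartesianProduct (λ X′ Y → indicator (rank-i-close X′ Y)) (allMats F n) (allMats F n) ⟩
      sumBy (λ X′ → tally (rank-i-close X′) (allMats F n)) (allMats F n)            ≡⟨ sumBy-cong (λ X′ → tally-∧ (rank-i X′) (close X′) (allMats F n)) (allMats F n) ⟩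
      sumBy (λ X′ → indicator (rank-i X′) * tally (close X′) (allMats F n)) (allMats F n)
                                                                    ≤⟨ sumBy-indicator-*-≤ rank-i _ (2 * S)
                                                                         (λ X′ h → close-count≤2S X′ (does⇒ (rk F X′ ℕₚ.≟ i) h)) (allMats F n) ⟩
      tally rank-i (allMats F n) * (2 * S)                                  ≡⟨ cong (_* (2 * S)) (count≡tally rank-i (allMats F n)) ⟨
      Mcount F n i * (2 * S)                                        ∎
      where
      open ℕₚ.≤-Reasoning
      rank-i : Mat F n → Bool
      rank-i X′ = _=ℕ_ F (rk F X′) i
      rank-i-close : Mat F n → Mat F n → Bool
      rank-i-close X′ Y = rank-i X′ ∧ close X′ Y

open import Data.Nat using (ℕ; _+_; _*_; _∸_; _≤_; _≥_)
open import Relation.Binary.PropositionalEquality using (_≡_)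

corollary4p10 : (q : ℕ) → IsPrimePower q →
    (F : FiniteField) → FiniteField.card F ≡ q →
    (n i j k : ℕ) → i ≤ n → j ≤ n → k ≤ n → i ≥ j → i + j ≥ k →
    (X : Mat F n) → rk F X ≡ i →
    Pcount F n i j k ≤
      Mcount F n i * (2 * sumFromTo (ceilHalf (i + j ∸ k)) j (λ c → Qcount F n X j c))
corollary4p10 q _ F _ n i j k _ _ _ _ _ X rkX≡i = Bound.bound F i j k X rkX≡i
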